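{- Let $\{D_1,\dots,D_m\}$ be a nontrivial $(v,m,k,\lambda)$-SEDF in a finite abelian group $G$ with $m>2$, having the simple character value property with respect to $(a,b)$. Then $$|\widehat{G}^0|=(v-1)\Big(1-\frac{(b^2-a^2)(v-km)m}{4a^2k(m-1)}\Big),$$ $$|\widehat{G}^+|=\frac{(v-1)(v-km)(b^2-a^2)((b-a)m+2a)}{8a^2bk(m-1)},\qquad |\widehat{G}^-|=\frac{(v-1)(v-km)(b^2-a^2)((b+a)m-2a)}{8a^2bk(m-1)},$$ and each of $|\widehat{G}^0|,|\widehat{G}^+|,|\widehat{G}^-|$ is a non-negative integer and $|\widehat{G}^+|+|\widehat{G}^-|>0$.
   Context: Groups are finite abelian, written multiplicatively with identity $1$. For a subset $A\subseteq G$ we also write $A$ for $\sum_{a\in A}a\in\mathbb{Z}[G]$ and $A^{(-1)}=\sum_{a\in A}a^{ -1}$. Given integers $m\ge 2$, $k\ge1$, $\lambda\ge 1$ and a group $G$ of order $v$, mutually disjoint $k$-subsets $D_1,\dots,D_m$ form a $(v,m,k,\lambda)$-SEDF in $G$ if $D_j\sum_{i\ne j}D_i^{(-1)}=\lambda(G-1)$ in $\mathbb{Z}[G]$ for each $j$; nontrivial means $k>1$. $\widehat{G}$ is the character group, characters extended linearly to $\mathbb{Z}[G]$. Let $D=\bigcup_iD_i$; $\widehat{G}^0$ is the set of nonprincipal $\chi$ with $\chi(D)=0$ and $\widehat{G}^N$ the set of nonprincipal $\chi$ with $\chi(D)\ne0$. For a nontrivial SEDF with $m>2$ and $\chi\in\widehat{G}^N$,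 $\sqrt{1+4\lambda/|\chi(D)|^2}$ is rational; write it $b_\chi/a_\chi$ with integers $b_\chi>a_\chi>0$, $\gcd(a_\chi,b_\chi)=1$. The SEDF has the simple character value property with respect to $(a,b)$ if $(a_\chi,b_\chi)=(a,b)$ for all $\chi\in\widehat{G}^N$. In that case define $\widehat{G}^+=\{\chi\in\widehat{G}^N:\chi(D_1)=\frac{a+b}{2a}\chi(D)\}$ and $\widehat{G}^-=\{\chi\in\widehat{G}^N:\chi(D_1)=\frac{a-b}{2a}\chi(D)\}$. -}

module Defs where

open import Level using (Level; _⊔_)
open import Data.Bool.Base using (Bool; true; false; not; _∧_)
open import Data.Nat.Base using (ℕ; zero; suc; _≤_)
import Data.Nat.Base as N
open import Data.Fin.Base using (Fin)
import Data.Fin.Properties as FinP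
open import Data.List.Base using (List; []; _∷_; map; allFin; cartesianProduct; foldr)
open import Data.Product.Base using (_×_; _,_; Σ; proj₁; proj₂)
open import Data.Sum.Base using (_⊎_)
open import Relation.Nullary using (¬_; does)
open import Relation.Binary.Definitions using (Decidable)
open import Relation.Binary.PropositionalEquality using (_≡_)
open import Algebra.Bundles using (AbelianGroup; CommutativeRing)

private variable c ℓ c' ℓ' : Level

cnt : ∀ {a} {A : Set a} → (A → Bool) → List A → ℕ
cnt p [] = 0
cnt p (x ∷ xs) = (if p x then 1 else 0) N.+ cnt p xs
  where open import Data.Bool.Base using (if_then_else_)

ΣFin : (m : ℕ) → (Fin m → ℕ) → ℕ
ΣFin m f = foldr (λ i r → f i N.+ r) 0 (allFin m)

record FiniteAbelianGroup (c ℓ : Level) : Set (Level.suc (c ⊔ ℓ)) where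
  field
    abGroup : AbelianGroup c ℓ
  open AbelianGroup abGroup public
  field
    _≟_   : Decidable _≈_
    elems : List Carrier
    elems-enum : ∀ g → cnt (λ x → does (x ≟ g)) elems ≡ 1

  order : ℕ
  order = Data.List.Base.length elems
    where import Data.List.Base

  mult : Carrier → List Carrier → ℕ
  mult g xs = cnt (λ x → does (x ≟ g)) xs

-- SEDF in a finite abelian group. Subsets are given as lists
-- (a k-subset = a duplicate-free list of length k).

module _ (G : FiniteAbelianGroup c ℓ) where
  open FiniteAbelianGroup G

  IsKSubset : ℕ → List Carrier → Set c
  IsKSubset k A = (∀ g → mult g A ≤ 1) × Data.List.Base.length A ≡ k
    where import Data.List.Base

  -- coefficient of g in the group-ring element  D_j ∑_{i≠j} D_i^(-1)
  sedfCoeff : (m : ℕ) → (Fin m → List Carrier) → Fin m → Carrier → ℕ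
  sedfCoeff m Ds j g =
    ΣFin m (λ i → if does (i FinP.≟ j) then 0
                  else cnt (λ xy → does ((proj₁ xy ∙ (proj₂ xy) ⁻¹) ≟ g))
                            (cartesianProduct (Ds j) (Ds i)))
    where open import Data.Bool.Base using (if_then_else_)

  record IsSEDF (m k lam : ℕ) (Ds : Fin m → List Carrier) : Set (c ⊔ ℓ) where
    field
      m≥2      : 2 ≤ m
      k≥1      : 1 ≤ k
      lam≥1    : 1 ≤ lam
      ksubsets : ∀ i → IsKSubset k (Ds i)
      disjoint : ∀ i j → ¬ i ≡ j → ∀ g → mult g (Ds i) ≡ 0 ⊎ mult g (Ds j) ≡ 0
      -- D_j ∑_{i≠j} D_i^(-1) = λ(G - 1) in ℤ[G], coefficientwise
      coeff-1  : ∀ j → sedfCoeff m Ds j ε ≡ 0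
      coeff-g  : ∀ j g → ¬ g ≈ ε → sedfCoeff m Ds j g ≡ lam

module _ (K : CommutativeRing c' ℓ') where
  open CommutativeRing K

  ι : ℕ → Carrier
  ι zero = 0#
  ι (suc n) = 1# + ι n

  record IsChar0DecDomain : Set (c' ⊔ ℓ') where
    field
      _≈?_      : Decidable _≈_
      1≉0       : ¬ 1# ≈ 0#
      no-zero-divisors : ∀ x y → x * y ≈ 0# → x ≈ 0# ⊎ y ≈ 0#
      char0     : ∀ n → ι n ≈ 0# → n ≡ 0

module _ (G : FiniteAbelianGroup c ℓ) (K : CommutativeRing c' ℓ') where
  private module G = FiniteAbelianGroup G
  open CommutativeRing K

  record Character : Set (c ⊔ ℓ ⊔ c' ⊔ ℓ') where
    field
      χ      : G.Carrier → Carrier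
      χ-cong : ∀ {x y} → x G.≈ y → χ x ≈ χ y
      χ-hom  : ∀ x y → χ (x G.∙ y) ≈ χ x * χ y
      χ-ε    : χ G.ε ≈ 1#
  open Character public

  PointwiseEq : Character → Character → Set (c ⊔ ℓ')
  PointwiseEq ψ φ = ∀ g → χ ψ g ≈ χ φ g

  Principal : Character → Set (c ⊔ ℓ')
  Principal ψ = ∀ g → χ ψ g ≈ 1#

  record IsCharacterGroup (n : ℕ) (chars : Fin n → Character) : Set (c ⊔ ℓ ⊔ c' ⊔ ℓ') where
    field
      complete  : ∀ ψ → Σ (Fin n) λ i → PointwiseEq (chars i) ψ
      injective : ∀ i j → PointwiseEq (chars i) (chars j) → i ≡ j

  χΣ : Character → List G.Carrier → Carrier
  χΣ ψ A = foldr (λ x r → χ ψ x + r) 0# A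

  χΣinv : Character → List G.Carrier → Carrier
  χΣinv ψ A = foldr (λ x r → χ ψ (x G.⁻¹) + r) 0# A

  χD : (m : ℕ) → (Fin m → List G.Carrier) → Character → Carrier
  χD m Ds ψ = foldr (λ i r → χΣ ψ (Ds i) + r) 0# (allFin m)

  χDinv : (m : ℕ) → (Fin m → List G.Carrier) → Character → Carrier
  χDinv m Ds ψ = foldr (λ i r → χΣinv ψ (Ds i) + r) 0# (allFin m)

  -- D_1, the first block (index 0)
  firstIdx : ∀ {m} → 2 N.< m → Fin m
  firstIdx {suc m} _ = Fin.zero
    where import Data.Fin.Base as Fin

  -- simple character value property w.r.t. (a,b):  for every
  -- nonprincipal χ with χ(D) ≠ 0,  sqrt(1 + 4λ/|χ(D)|²) = b/a,
  -- written as (b² - a²)·χ(D)·χ(D^(-1)) = 4λa²  (|χ(D)|² = χ(D)χ(D^(-1))),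
  -- with 0 < a < b and gcd(a,b) = 1.
  SimpleCharValueProp : (m lam : ℕ) → (Fin m → List G.Carrier) → (a b : ℕ) → Set (c ⊔ ℓ ⊔ c' ⊔ ℓ')
  SimpleCharValueProp m lam Ds a b =
    (0 N.< a) × (a N.< b) × (Data.Nat.GCD.gcd a b ≡ 1) ×
    (∀ ψ → ¬ Principal ψ → ¬ χD m Ds ψ ≈ 0# →
       ι K (b N.* b N.∸ a N.* a) * (χD m Ds ψ * χDinv m Ds ψ) ≈ ι K (4 N.* lam N.* a N.* a))
    where import Data.Nat.GCD

  module Counts (dom : IsChar0DecDomain K) (n : ℕ) (chars : Fin n → Character)
                (m : ℕ) (Ds : Fin m → List G.Carrier) (i₁ : Fin m) (a b : ℕ) where
    open IsChar0DecDomain dom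
    open import Data.Bool.Base using (_∨_)

    anyB : List G.Carrier → (G.Carrier → Bool) → Bool
    anyB xs p = foldr (λ x r → p x ∨ r) false xs

    nonPrincipalB : Character → Bool
    nonPrincipalB ψ = anyB G.elems (λ g → not (does (χ ψ g ≈? 1#)))

    inNB : Character → Bool
    inNB ψ = nonPrincipalB ψ ∧ not (does (χD m Ds ψ ≈? 0#))

    in0B : Character → Bool
    in0B ψ = nonPrincipalB ψ ∧ does (χD m Ds ψ ≈? 0#)

    -- χ ∈ Ĝ^+ :  χ(D_1) = (a+b)/(2a) χ(D), i.e. 2a χ(D_1) = (a+b) χ(D)
    inPlusB : Character → Bool
    inPlusB ψ = inNB ψ ∧ does ((ι K (2 N.* a) * χΣ ψ (Ds i₁)) ≈? (ι K (a N.+ b) * χD m Ds ψ))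

    -- χ ∈ Ĝ^- :  χ(D_1) = (a-b)/(2a) χ(D), i.e. 2a χ(D_1) + (b-a) χ(D) = 0
    inMinusB : Character → Bool
    inMinusB ψ = inNB ψ ∧ does (((ι K (2 N.* a) * χΣ ψ (Ds i₁)) + (ι K (b N.∸ a) * χD m Ds ψ)) ≈? 0#)

    countChars : (Character → Bool) → ℕ
    countChars p = cnt (λ i → p (chars i)) (allFin n)

    #G0 #G+ #G- : ℕ
    #G0 = countChars in0B
    #G+ = countChars inPlusB
    #G- = countChars inMinusB

module Submission where

-- For a character χ write t = χ(D₁), X = χ(D) and Y = χ(D⁻¹). Read through χ, the SEDF equation
-- gives χ(D_j)·χ(D⁻¹) = |χ(D_j)|² − λ for every nonprincipal χ; with (b² − a²)·X·Y = 4λa² this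
-- forces (2a·t − (a + b)·X)·(2a·t + (b − a)·X) = 0 when X ≠ 0, so each nonprincipal character lies
-- in exactly one of Ĝ⁰, Ĝ⁺, Ĝ⁻. Summing over Ĝ, the partition of Ĝ, Parseval's identity
-- ∑ |χ(D)|² = v·mk and the correlation ∑ χ(D₁)·χ(D⁻¹) = v·k are three linear equations in the three
-- counts, which together with k²(m − 1) = λ(v − 1) (the principal character) yield the formulas.
-- If Ĝ⁺ and Ĝ⁻ were empty, Parseval would give v = mk and |χ(D₁)|² = λ for all χ ≠ 1; Fourier
-- inversion then gives k² = v·μ + λ for the number μ ≥ 1 of ways a nonidentity quotient of two
-- elements of D₁ arises, which is incompatible with k²(m − 1) = λ(v − 1).

open import Defs
open import Level using (Level; _⊔_)
open import Function.Base using (_∘_)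
open import Data.Bool.Base using (Bool; true; false; not; _∧_; _∨_; if_then_else_)
open import Data.Nat.Base as ℕ using (ℕ; zero; suc; z≤n; s≤s)
import Data.Nat.Properties as ℕP
import Data.Nat.Tactic.RingSolver as ℕSolver
open import Data.Nat.Divisibility using (_∣_; divides; ∣⇒≤; ∣m+n∣m⇒∣n)
open import Data.Integer.Base as ℤ using (ℤ; +_; -[1+_])
import Data.Integer.Properties as ℤP
open import Data.Fin.Base using (Fin)
import Data.Fin.Base as Fin
import Data.Fin.Properties as FinP
open import Data.List.Base using (List; []; _∷_; foldr; map; _++_; length; allFin; tabulate; cartesianProduct)
import Data.List.Properties as ListP
open import Data.List.Membership.Propositional using (_∈_)
open import Data.List.Membership.Propositional.Properties using (∈-allFin; ∈-cartesianProduct⁺)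
open import Data.List.Relation.Unary.Any using (Any; here; there; any?)
import Data.List.Relation.Unary.Any as Any
open import Data.List.Relation.Unary.All using (all?)
import Data.List.Relation.Unary.All as All
open import Data.List.Relation.Unary.All.Properties using (¬Any⇒All¬; ¬All⇒Any¬)
open import Data.Maybe.Base using (Maybe; just; nothing)
open import Data.Product.Base using (_×_; _,_; ∃; proj₁; proj₂)
open import Data.Sum.Base using (_⊎_; inj₁; inj₂; [_,_]′)
import Data.Sum.Base as Sum
open import Data.Empty using (⊥; ⊥-elim)
open import Data.Bool.Properties using (¬-not)
open import Relation.Nullary using (¬_; Dec; yes; no; does; proof; contradiction)
open import Relation.Nullary.Reflects using (Reflects; ofʸ; ofⁿ)
open import Relation.Nullary.Decidable using (dec-true; dec-false; ¬?; decidable-stable; map′)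
open import Relation.Binary.PropositionalEquality as ≡ using (_≡_)
open import Algebra.Bundles using (CommutativeRing)
open import Data.Fin.Permutation using (Permutation′; permutation; _⟨$⟩ʳ_)
open import Algebra.Solver.Ring.AlmostCommutativeRing using (fromCommutativeRing; _-Raw-AlmostCommutative⟶_)

private variable
  a a′ : Level
  A : Set a
  A′ : Set a′

not≡true : ∀ {x} → not x ≡ true → x ≡ false
not≡true {false} _ = ≡.refl

∧-not-∧ : ∀ {x y z} → x ≡ true → y ≡ false → z ≡ true → (x ∧ not y) ∧ z ≡ true
∧-not-∧ ≡.refl ≡.refl ≡.refl = ≡.refl

witness : {P : Set a} (P? : Dec P) → does P? ≡ true → P
witness (yes p) _ = p

refutation : {P : Set a} (P? : Dec P) → does P? ≡ false → ¬ P
refutation (no ¬p) _ = ¬p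

does-cong : {P : Set a} {Q : Set a′} → (P → Q) → (Q → P) → (P? : Dec P) (Q? : Dec Q) → does P? ≡ does Q?
does-cong f g P? Q? with does Q? in eq
... | true  = dec-true P? (g (witness Q? eq))
... | false = dec-false P? (refutation Q? eq ∘ f)

foldr-∨-does : ∀ {p} {P : A → Set p} (P? : ∀ x → Dec (P x)) xs →
               foldr (λ x r → does (P? x) ∨ r) false xs ≡ does (any? P? xs)
foldr-∨-does P? []       = ≡.refl
foldr-∨-does P? (x ∷ xs) = ≡.cong (does (P? x) ∨_) (foldr-∨-does P? xs)

cnt-cong : {p q : A → Bool} → (∀ x → p x ≡ q x) → ∀ xs → cnt p xs ≡ cnt q xs
cnt-cong p≗q []       = ≡.refl
cnt-cong p≗q (x ∷ xs) rewrite p≗q x = ≡.cong (_ ℕ.+_) (cnt-cong p≗q xs)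

cnt-map : ∀ (p : A′ → Bool) (f : A → A′) xs → cnt p (map f xs) ≡ cnt (p ∘ f) xs
cnt-map p f []       = ≡.refl
cnt-map p f (x ∷ xs) = ≡.cong (_ ℕ.+_) (cnt-map p f xs)

cnt-++ : ∀ (p : A → Bool) xs ys → cnt p (xs ++ ys) ≡ cnt p xs ℕ.+ cnt p ys
cnt-++ p []       ys = ≡.refl
cnt-++ p (x ∷ xs) ys =
  ≡.trans (≡.cong (_ ℕ.+_) (cnt-++ p xs ys)) (≡.sym (ℕP.+-assoc (if p x then 1 else 0) (cnt p xs) (cnt p ys)))

cnt≡0⇒false : ∀ (p : A → Bool) {x} xs → cnt p xs ≡ 0 → x ∈ xs → p x ≡ false
cnt≡0⇒false p (y ∷ xs) eq x∈ with p y in py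
cnt≡0⇒false p (y ∷ xs) eq (here ≡.refl) | false = py
cnt≡0⇒false p (y ∷ xs) eq (there x∈)    | false = cnt≡0⇒false p xs eq x∈

cnt-pos⇒witness : ∀ (p : A → Bool) xs {k} → cnt p xs ≡ suc k → ∃ λ x → x ∈ xs × p x ≡ true
cnt-pos⇒witness p (x ∷ xs) eq with p x in px
... | true  = x , here ≡.refl , px
... | false = let y , y∈ , py = cnt-pos⇒witness p xs eq in y , there y∈ , py

∈⇒1≤cnt : ∀ (p : A → Bool) {x} xs → x ∈ xs → p x ≡ true → 1 ℕ.≤ cnt p xs
∈⇒1≤cnt p (y ∷ xs) (here ≡.refl) px rewrite px = s≤s z≤n
∈⇒1≤cnt p (y ∷ xs) (there x∈)    px = ℕP.≤-trans (∈⇒1≤cnt p xs x∈ px) (ℕP.m≤n+m _ _)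

cnt-disjoint : ∀ (p q r : A → Bool) →
               (∀ x → q x ≡ true → p x ≡ true) → (∀ x → r x ≡ true → p x ≡ true) →
               (∀ x → q x ≡ true → r x ≡ false) →
               ∀ xs → cnt q xs ℕ.+ cnt r xs ℕ.≤ cnt p xs
cnt-disjoint p q r q⊆p r⊆p q∩r xs = go xs
  where
  go : ∀ xs → cnt q xs ℕ.+ cnt r xs ℕ.≤ cnt p xs
  go []       = z≤n
  go (x ∷ xs) with q x in qx | r x in rx
  ... | true  | true  = contradiction (≡.trans (≡.sym (q∩r x qx)) rx) λ ()
  ... | true  | false rewrite q⊆p x qx = s≤s (go xs)
  ... | false | true  rewrite r⊆p x rx = ≡.subst (ℕ._≤ suc (cnt p xs)) (≡.sym (ℕP.+-suc _ _)) (s≤s (go xs))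
  ... | false | false = ℕP.≤-trans (go xs) (ℕP.m≤n+m _ _)

cnt-false : {p : A → Bool} → (∀ x → p x ≡ false) → ∀ xs → cnt p xs ≡ 0
cnt-false p≡false []       = ≡.refl
cnt-false p≡false (x ∷ xs) rewrite p≡false x = cnt-false p≡false xs

length-allFin : ∀ n → length (allFin n) ≡ n
length-allFin n = ListP.length-tabulate (λ i → i)

cnt-allFin-suc : ∀ {n} (p : Fin (suc n) → Bool) →
                 cnt p (allFin (suc n)) ≡ (if p Fin.zero then 1 else 0) ℕ.+ cnt (p ∘ Fin.suc) (allFin n)
cnt-allFin-suc {n} p = ≡.cong ((if p Fin.zero then 1 else 0) ℕ.+_)
  (≡.trans (≡.cong (cnt p) (≡.sym (ListP.map-tabulate (λ i → i) Fin.suc))) (cnt-map p Fin.suc (allFin n)))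

cnt-allFin-unique : ∀ {n} (p : Fin n → Bool) (i : Fin n) → p i ≡ true → (∀ j → p j ≡ true → j ≡ i) →
                    cnt p (allFin n) ≡ 1
cnt-allFin-unique {suc n} p Fin.zero p0 unique = ≡.trans (cnt-allFin-suc p)
  (≡.cong₂ (λ b c → (if b then 1 else 0) ℕ.+ c) p0
           (cnt-false (λ j → ¬-not (λ psj → FinP.0≢1+n (≡.sym (unique (Fin.suc j) psj)))) (allFin n)))
cnt-allFin-unique {suc n} p (Fin.suc i) pi unique = ≡.trans (cnt-allFin-suc p)
  (≡.cong₂ (λ b c → (if b then 1 else 0) ℕ.+ c) (¬-not (λ p0 → FinP.0≢1+n (unique Fin.zero p0)))
           (cnt-allFin-unique (p ∘ Fin.suc) i pi (λ j psj → FinP.suc-injective (unique (Fin.suc j) psj))))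

-- The two relations give k = μ + l and k ∣ μ, whereas 0 < μ < k.
square-relations-incompatible : ∀ m k μ l → 0 ℕ.< m → 1 ℕ.≤ μ → 1 ℕ.≤ l →
                                k ℕ.* (m ℕ.* k) ℕ.+ l ≡ k ℕ.* k ℕ.+ l ℕ.* (m ℕ.* k) →
                                k ℕ.* k ≡ m ℕ.* k ℕ.* μ ℕ.+ l → ⊥
square-relations-incompatible m zero μ l _ _ 1≤l _ k²≡ = ℕP.<⇒≢ 1≤l (≡.sym (ℕP.m+n≡0⇒n≡0 (m ℕ.* 0 ℕ.* μ) (≡.sym k²≡)))
square-relations-incompatible m k@(suc _) μ l 0<m 1≤μ 1≤l principal k²≡ = ℕP.<⇒≱ μ<k (∣⇒≤ k∣μ)
  where
  open ≡.≡-Reasoning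
  instance
    _ : ℕ.NonZero (m ℕ.* k)
    _ = ℕP.m*n≢0 m k {{ℕ.>-nonZero 0<m}}
    _ : ℕ.NonZero μ
    _ = ℕ.>-nonZero 1≤μ
  k≡μ+l : k ≡ μ ℕ.+ l
  k≡μ+l = ℕP.*-cancelˡ-≡ k (μ ℕ.+ l) (m ℕ.* k) (ℕP.+-cancelʳ-≡ l _ _ (begin
    m ℕ.* k ℕ.* k ℕ.+ l                       ≡⟨ ≡.cong (ℕ._+ l) (ℕP.*-comm (m ℕ.* k) k) ⟩
    k ℕ.* (m ℕ.* k) ℕ.+ l                     ≡⟨ principal ⟩
    k ℕ.* k ℕ.+ l ℕ.* (m ℕ.* k)               ≡⟨ ≡.cong (ℕ._+ l ℕ.* (m ℕ.* k)) k²≡ ⟩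
    m ℕ.* k ℕ.* μ ℕ.+ l ℕ.+ l ℕ.* (m ℕ.* k)   ≡⟨ regroup (m ℕ.* k) μ l ⟩
    m ℕ.* k ℕ.* (μ ℕ.+ l) ℕ.+ l               ∎))
    where
    regroup : ∀ x μ l → x ℕ.* μ ℕ.+ l ℕ.+ l ℕ.* x ≡ x ℕ.* (μ ℕ.+ l) ℕ.+ l
    regroup = ℕSolver.solve-∀
  k∣μ : k ∣ μ
  k∣μ = ∣m+n∣m⇒∣n (divides (m ℕ.* μ ℕ.+ 1) (begin
    k ℕ.* k ℕ.+ μ               ≡⟨ ≡.cong (ℕ._+ μ) k²≡ ⟩
    m ℕ.* k ℕ.* μ ℕ.+ l ℕ.+ μ   ≡⟨ ℕP.+-assoc (m ℕ.* k ℕ.* μ) l μ ⟩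
    m ℕ.* k ℕ.* μ ℕ.+ (l ℕ.+ μ) ≡⟨ ≡.cong (m ℕ.* k ℕ.* μ ℕ.+_) (≡.trans (ℕP.+-comm l μ) (≡.sym k≡μ+l)) ⟩
    m ℕ.* k ℕ.* μ ℕ.+ k         ≡⟨ factor m k μ ⟩
    (m ℕ.* μ ℕ.+ 1) ℕ.* k       ∎)) (divides k ≡.refl)
    where
    factor : ∀ m k μ → m ℕ.* k ℕ.* μ ℕ.+ k ≡ (m ℕ.* μ ℕ.+ 1) ℕ.* k
    factor = ℕSolver.solve-∀
  μ<k : μ ℕ.< k
  μ<k = ≡.subst (μ ℕ.<_) (≡.sym k≡μ+l) (≡.subst (ℕ._≤ μ ℕ.+ l) (ℕP.+-comm μ 1) (ℕP.+-monoʳ-≤ μ 1≤l))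

module IntegerCounting where
  open import Data.Integer.Base using (_+_; _*_; _-_; -_)
  import Data.Integer.Tactic.RingSolver as ℤSolver

  cancel-nonzero : ∀ k {x y} .{{_ : ℤ.NonZero k}} → k * (x - y) ≡ + 0 → x ≡ y
  cancel-nonzero k {x} {y} k[x-y]≡0 = ℤP.i-j≡0⇒i≡j x y (ℤP.*-cancelˡ-≡ k (x - y) (+ 0) (≡.trans k[x-y]≡0 (≡.sym (ℤP.*-zeroʳ k))))

  combination≡0 : ∀ e₁ e₂ e₃ e₄ {x₁ y₁ x₂ y₂ x₃ y₃ x₄ y₄} → x₁ ≡ y₁ → x₂ ≡ y₂ → x₃ ≡ y₃ → x₄ ≡ y₄ →
                  e₁ * (x₁ - y₁) + e₂ * (x₂ - y₂) + e₃ * (x₃ - y₃) + e₄ * (x₄ - y₄) ≡ + 0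
  combination≡0 e₁ e₂ e₃ e₄ {x₁} {_} {x₂} {_} {x₃} {_} {x₄} ≡.refl ≡.refl ≡.refl ≡.refl = vanish e₁ e₂ e₃ e₄ x₁ x₂ x₃ x₄
    where
    vanish : ∀ e₁ e₂ e₃ e₄ x₁ x₂ x₃ x₄ → e₁ * (x₁ - x₁) + e₂ * (x₂ - x₂) + e₃ * (x₃ - x₃) + e₄ * (x₄ - x₄) ≡ + 0
    vanish = ℤSolver.solve-∀

  -- k times each formula is an explicit ℤ-linear combination of the four hypotheses.
  count-identities :
    ∀ {v m k l a b z₀ z₊ z₋ B F A₂ D₋ D₊ X₄ X₈ V₁ KM P₊ P₋} .{{_ : ℤ.NonZero k}} →
    B ≡ b * b - a * a → F ≡ + 4 * l * a * a → A₂ ≡ + 2 * a → D₋ ≡ b - a → D₊ ≡ a + b →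
    X₄ ≡ + 4 * a * a * k * (m - + 1) → X₈ ≡ + 8 * a * a * b * k * (m - + 1) → V₁ ≡ v - + 1 → KM ≡ k * m →
    P₊ ≡ (b - a) * m + + 2 * a → P₋ ≡ (b + a) * m - + 2 * a →
    v ≡ + 1 + z₀ + z₊ + z₋ →
    B * (m * (v * k)) ≡ + 1 * (B * ((m * k) * (m * k))) + (z₊ + z₋) * F →
    A₂ * (B * (v * k)) + z₋ * (D₋ * F) ≡ + 1 * (A₂ * (B * (k * (m * k)))) + z₊ * (D₊ * F) →
    k * (m * k) + l ≡ k * k + l * v →
    z₀ * X₄ ≡ V₁ * (X₄ - B * (v - KM) * m) × z₊ * X₈ ≡ V₁ * (v - KM) * B * P₊ × z₋ * X₈ ≡ V₁ * (v - KM) * B * P₋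
  count-identities {v} {m} {k} {l} {a} {b} {z₀} {z₊} {z₋}
    ≡.refl ≡.refl ≡.refl ≡.refl ≡.refl ≡.refl ≡.refl ≡.refl ≡.refl ≡.refl ≡.refl partition parseval correlation principal =
      cancel-nonzero k (≡.trans (certificate₀ v m k l a b z₀ z₊ z₋)
        (combination≡0 (- (+ 4 * a * a * k * k * (m - + 1))) (v - + 1) (+ 0) (- ((z₊ + z₋) * (+ 4 * a * a)))
                       partition parseval correlation principal)) ,
      cancel-nonzero k (≡.trans (certificate₊ v m k l a b z₀ z₊ z₋)
        (combination≡0 (+ 0) (- ((v - + 1) * (b - a))) (- (v - + 1)) (+ 8 * a * a * b * z₊)
                       partition parseval correlation principal)) ,
      cancel-nonzero k (≡.trans (certificate₋ v m k l a b z₀ z₊ z₋)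
        (combination≡0 (+ 0) (- ((v - + 1) * (b + a))) (v - + 1) (+ 8 * a * a * b * z₋)
                       partition parseval correlation principal))
    where
    certificate₀ : ∀ v m k l a b z₀ z₊ z₋ →
      k * (z₀ * (+ 4 * a * a * k * (m - + 1)) - (v - + 1) * (+ 4 * a * a * k * (m - + 1) - (b * b - a * a) * (v - k * m) * m))
        ≡ (- (+ 4 * a * a * k * k * (m - + 1))) * (v - (+ 1 + z₀ + z₊ + z₋))
          + (v - + 1) * ((b * b - a * a) * (m * (v * k)) - (+ 1 * ((b * b - a * a) * ((m * k) * (m * k))) + (z₊ + z₋) * (+ 4 * l * a * a)))
          + + 0 * ((+ 2 * a) * ((b * b - a * a) * (v * k)) + z₋ * ((b - a) * (+ 4 * l * a * a))
                   - (+ 1 * ((+ 2 * a) * ((b * b - a * a) * (k * (m * k)))) + z₊ * ((a + b) * (+ 4 * l * a * a))))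
          + (- ((z₊ + z₋) * (+ 4 * a * a))) * ((k * (m * k) + l) - (k * k + l * v))
    certificate₀ = ℤSolver.solve-∀
    certificate₊ : ∀ v m k l a b z₀ z₊ z₋ →
      k * (z₊ * (+ 8 * a * a * b * k * (m - + 1)) - (v - + 1) * (v - k * m) * (b * b - a * a) * ((b - a) * m + + 2 * a))
        ≡ + 0 * (v - (+ 1 + z₀ + z₊ + z₋))
          + (- ((v - + 1) * (b - a))) * ((b * b - a * a) * (m * (v * k)) - (+ 1 * ((b * b - a * a) * ((m * k) * (m * k))) + (z₊ + z₋) * (+ 4 * l * a * a)))
          + (- (v - + 1)) * ((+ 2 * a) * ((b * b - a * a) * (v * k)) + z₋ * ((b - a) * (+ 4 * l * a * a))
                   - (+ 1 * ((+ 2 * a) * ((b * b - a * a) * (k * (m * k)))) + z₊ * ((a + b) * (+ 4 * l * a * a))))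
          + (+ 8 * a * a * b * z₊) * ((k * (m * k) + l) - (k * k + l * v))
    certificate₊ = ℤSolver.solve-∀
    certificate₋ : ∀ v m k l a b z₀ z₊ z₋ →
      k * (z₋ * (+ 8 * a * a * b * k * (m - + 1)) - (v - + 1) * (v - k * m) * (b * b - a * a) * ((b + a) * m - + 2 * a))
        ≡ + 0 * (v - (+ 1 + z₀ + z₊ + z₋))
          + (- ((v - + 1) * (b + a))) * ((b * b - a * a) * (m * (v * k)) - (+ 1 * ((b * b - a * a) * ((m * k) * (m * k))) + (z₊ + z₋) * (+ 4 * l * a * a)))
          + (v - + 1) * ((+ 2 * a) * ((b * b - a * a) * (v * k)) + z₋ * ((b - a) * (+ 4 * l * a * a))
                   - (+ 1 * ((+ 2 * a) * ((b * b - a * a) * (k * (m * k)))) + z₊ * ((a + b) * (+ 4 * l * a * a))))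
          + (+ 8 * a * a * b * z₋) * ((k * (m * k) + l) - (k * k + l * v))
    certificate₋ = ℤSolver.solve-∀

module FiniteSums {c ℓ} (R : CommutativeRing c ℓ) where
  open CommutativeRing R
  open import Relation.Binary.Reasoning.Setoid setoid
  open import Algebra.Properties.CommutativeSemigroup +-commutativeSemigroup using (interchange)
  open import Algebra.Properties.AbelianGroup +-abelianGroup using (⁻¹-∙-comm)
  open import Algebra.Properties.Ring ring using (-0#≈0#)
  open import Algebra.Properties.CommutativeMonoid.Sum +-commutativeMonoid using (sum; sum-permute)

  ∑ : (A → Carrier) → List A → Carrier
  ∑ f = foldr (λ x r → f x + r) 0#

  𝟙 : Bool → Carrier
  𝟙 true  = 1#
  𝟙 false = 0#

  ι-+ : ∀ m n → ι R (m ℕ.+ n) ≈ ι R m + ι R n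
  ι-+ zero    n = sym (+-identityˡ _)
  ι-+ (suc m) n = trans (+-congˡ (ι-+ m n)) (sym (+-assoc _ _ _))

  ι-* : ∀ m n → ι R (m ℕ.* n) ≈ ι R m * ι R n
  ι-* zero    n = sym (zeroˡ _)
  ι-* (suc m) n = begin
    ι R (n ℕ.+ m ℕ.* n)           ≈⟨ ι-+ n (m ℕ.* n) ⟩
    ι R n + ι R (m ℕ.* n)         ≈⟨ +-cong (sym (*-identityˡ _)) (ι-* m n) ⟩
    1# * ι R n + ι R m * ι R n    ≈⟨ distribʳ _ _ _ ⟨
    (1# + ι R m) * ι R n          ∎

  ι-1 : ι R 1 ≈ 1#
  ι-1 = +-identityʳ 1#

  ∑-cong : {f g : A → Carrier} → (∀ x → f x ≈ g x) → ∀ xs → ∑ f xs ≈ ∑ g xs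
  ∑-cong f≈g []       = refl
  ∑-cong f≈g (x ∷ xs) = +-cong (f≈g x) (∑-cong f≈g xs)

  ∑-+ : ∀ (f g : A → Carrier) xs → ∑ (λ x → f x + g x) xs ≈ ∑ f xs + ∑ g xs
  ∑-+ f g []       = sym (+-identityˡ 0#)
  ∑-+ f g (x ∷ xs) = trans (+-congˡ (∑-+ f g xs)) (interchange (f x) (g x) (∑ f xs) (∑ g xs))

  ∑-0 : ∀ (xs : List A) → ∑ (λ _ → 0#) xs ≈ 0#
  ∑-0 []       = refl
  ∑-0 (x ∷ xs) = trans (+-identityˡ _) (∑-0 xs)

  ∑-neg : ∀ (f : A → Carrier) xs → ∑ (λ x → - f x) xs ≈ - ∑ f xs
  ∑-neg f []       = sym -0#≈0#
  ∑-neg f (x ∷ xs) = trans (+-congˡ (∑-neg f xs)) (⁻¹-∙-comm (f x) (∑ f xs))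

  *-distribˡ-∑ : ∀ y (f : A → Carrier) xs → y * ∑ f xs ≈ ∑ (λ x → y * f x) xs
  *-distribˡ-∑ y f []       = zeroʳ y
  *-distribˡ-∑ y f (x ∷ xs) = trans (distribˡ y (f x) (∑ f xs)) (+-congˡ (*-distribˡ-∑ y f xs))

  *-distribʳ-∑ : ∀ y (f : A → Carrier) xs → ∑ f xs * y ≈ ∑ (λ x → f x * y) xs
  *-distribʳ-∑ y f xs = trans (*-comm _ y) (trans (*-distribˡ-∑ y f xs) (∑-cong (λ x → *-comm y (f x)) xs))

  ∑-comm : ∀ (f : A → A′ → Carrier) xs ys → ∑ (λ x → ∑ (f x) ys) xs ≈ ∑ (λ y → ∑ (λ x → f x y) xs) ys
  ∑-comm f []       ys = sym (∑-0 ys)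
  ∑-comm f (x ∷ xs) ys = begin
    ∑ (f x) ys + ∑ (λ x → ∑ (f x) ys) xs       ≈⟨ +-congˡ (∑-comm f xs ys) ⟩
    ∑ (f x) ys + ∑ (λ y → ∑ (λ x → f x y) xs) ys ≈⟨ ∑-+ (f x) _ ys ⟨
    ∑ (λ y → f x y + ∑ (λ x → f x y) xs) ys      ∎

  ∑-++ : ∀ (f : A → Carrier) xs ys → ∑ f (xs ++ ys) ≈ ∑ f xs + ∑ f ys
  ∑-++ f []       ys = sym (+-identityˡ _)
  ∑-++ f (x ∷ xs) ys = trans (+-congˡ (∑-++ f xs ys)) (sym (+-assoc _ _ _))

  ∑-map : ∀ (f : A′ → Carrier) (g : A → A′) xs → ∑ f (map g xs) ≈ ∑ (f ∘ g) xs
  ∑-map f g []       = refl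
  ∑-map f g (x ∷ xs) = +-congˡ (∑-map f g xs)

  ∑-const : ∀ y (xs : List A) → ∑ (λ _ → y) xs ≈ ι R (length xs) * y
  ∑-const y []       = sym (zeroˡ y)
  ∑-const y (x ∷ xs) = begin
    y + ∑ (λ _ → y) xs            ≈⟨ +-cong (sym (*-identityˡ y)) (∑-const y xs) ⟩
    1# * y + ι R (length xs) * y  ≈⟨ distribʳ y 1# _ ⟨
    (1# + ι R (length xs)) * y    ∎

  ι-cnt : ∀ (p : A → Bool) xs → ι R (cnt p xs) ≈ ∑ (𝟙 ∘ p) xs
  ι-cnt p []       = refl
  ι-cnt p (x ∷ xs) with p x
  ... | true  = +-congˡ (ι-cnt p xs)
  ... | false = trans (ι-cnt p xs) (sym (+-identityˡ _))

  ι-foldr : ∀ (f : A → ℕ) xs → ι R (foldr (λ x r → f x ℕ.+ r) 0 xs) ≈ ∑ (ι R ∘ f) xs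
  ι-foldr f []       = refl
  ι-foldr f (x ∷ xs) = trans (ι-+ (f x) _) (+-congˡ (ι-foldr f xs))

  ∑-indicator : ∀ (p : A → Bool) y xs → ∑ (λ x → 𝟙 (p x) * y) xs ≈ ι R (cnt p xs) * y
  ∑-indicator p y xs = trans (sym (*-distribʳ-∑ y (𝟙 ∘ p) xs)) (*-congʳ (sym (ι-cnt p xs)))

  ∑-δ : ∀ {r} {_∼_ : A → A → Set r} (_∼?_ : ∀ x y → Dec (x ∼ y)) z (f : A → Carrier) →
        (∀ x → x ∼ z → f x ≈ f z) → ∀ xs →
        ∑ (λ x → 𝟙 (does (x ∼? z)) * f x) xs ≈ ι R (cnt (λ x → does (x ∼? z)) xs) * f z
  ∑-δ _∼?_ z f f-resp xs = trans (∑-cong δ-at xs) (∑-indicator (λ x → does (x ∼? z)) (f z) xs)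
    where
    δ-at : ∀ x → 𝟙 (does (x ∼? z)) * f x ≈ 𝟙 (does (x ∼? z)) * f z
    δ-at x with x ∼? z
    ... | yes x∼z = *-congˡ (f-resp x x∼z)
    ... | no  _   = trans (zeroˡ _) (sym (zeroˡ _))

  ∑-δ-unique : ∀ {r} {_∼_ : A → A → Set r} (_∼?_ : ∀ x y → Dec (x ∼ y)) z (f : A → Carrier) →
               (∀ x → x ∼ z → f x ≈ f z) → ∀ xs → cnt (λ x → does (x ∼? z)) xs ≡ 1 →
               ∑ (λ x → 𝟙 (does (x ∼? z)) * f x) xs ≈ f z
  ∑-δ-unique _∼?_ z f f-resp xs once =
    trans (∑-δ _∼?_ z f f-resp xs) (trans (*-congʳ (trans (reflexive (≡.cong (ι R) once)) ι-1)) (*-identityˡ (f z)))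

  ∑-allFin-δ : ∀ {n} (i : Fin n) (f : Fin n → Carrier) → ∑ (λ j → 𝟙 (does (j FinP.≟ i)) * f j) (allFin n) ≈ f i
  ∑-allFin-δ {n} i f = ∑-δ-unique FinP._≟_ i f (λ { j ≡.refl → refl }) (allFin n)
    (cnt-allFin-unique _ i (dec-true (i FinP.≟ i) ≡.refl) (λ j → witness (j FinP.≟ i)))

  ∑-allFin≈sum : ∀ {n} (f : Fin n → Carrier) → ∑ f (allFin n) ≈ sum f
  ∑-allFin≈sum {zero}  f = refl
  ∑-allFin≈sum {suc n} f = +-congˡ (begin
    ∑ f (tabulate Fin.suc)          ≡⟨ ≡.cong (∑ f) (ListP.map-tabulate (λ i → i) Fin.suc) ⟨
    ∑ f (map Fin.suc (allFin n))    ≈⟨ ∑-map f Fin.suc (allFin n) ⟩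
    ∑ (f ∘ Fin.suc) (allFin n)      ≈⟨ ∑-allFin≈sum (f ∘ Fin.suc) ⟩
    sum (f ∘ Fin.suc)               ∎)

  ∑-allFin-permute : ∀ {n} (f : Fin n → Carrier) (π : Permutation′ n) →
                     ∑ (f ∘ (π ⟨$⟩ʳ_)) (allFin n) ≈ ∑ f (allFin n)
  ∑-allFin-permute {n} f π = begin
    ∑ (f ∘ (π ⟨$⟩ʳ_)) (allFin n) ≈⟨ ∑-allFin≈sum (f ∘ (π ⟨$⟩ʳ_)) ⟩
    sum (f ∘ (π ⟨$⟩ʳ_))          ≈⟨ sum-permute f π ⟨
    sum f                        ≈⟨ ∑-allFin≈sum f ⟨
    ∑ f (allFin n)               ∎

-- Polynomial expressions over ℕ, used to move identities from K to ℤ.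
infixl 6 _⊕_
infixl 7 _⊛_

data ℕExpr : Set where
  ⌜_⌝     : ℕ → ℕExpr
  _⊕_ _⊛_ : ℕExpr → ℕExpr → ℕExpr

⟦_⟧ℕ : ℕExpr → ℕ
⟦ ⌜ x ⌝ ⟧ℕ = x
⟦ e ⊕ f ⟧ℕ = ⟦ e ⟧ℕ ℕ.+ ⟦ f ⟧ℕ
⟦ e ⊛ f ⟧ℕ = ⟦ e ⟧ℕ ℕ.* ⟦ f ⟧ℕ

⟦_⟧ℤ : ℕExpr → ℤ
⟦ ⌜ x ⌝ ⟧ℤ = + x
⟦ e ⊕ f ⟧ℤ = ⟦ e ⟧ℤ ℤ.+ ⟦ f ⟧ℤ
⟦ e ⊛ f ⟧ℤ = ⟦ e ⟧ℤ ℤ.* ⟦ f ⟧ℤ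

pos-⟦⟧ : ∀ e → + ⟦ e ⟧ℕ ≡ ⟦ e ⟧ℤ
pos-⟦⟧ ⌜ x ⌝   = ≡.refl
pos-⟦⟧ (e ⊕ f) = ≡.trans (ℤP.pos-+ ⟦ e ⟧ℕ ⟦ f ⟧ℕ) (≡.cong₂ ℤ._+_ (pos-⟦⟧ e) (pos-⟦⟧ f))
pos-⟦⟧ (e ⊛ f) = ≡.trans (ℤP.pos-* ⟦ e ⟧ℕ ⟦ f ⟧ℕ) (≡.cong₂ ℤ._*_ (pos-⟦⟧ e) (pos-⟦⟧ f))

⟦⟧ℕ⇒⟦⟧ℤ : ∀ e f → ⟦ e ⟧ℕ ≡ ⟦ f ⟧ℕ → ⟦ e ⟧ℤ ≡ ⟦ f ⟧ℤ
⟦⟧ℕ⇒⟦⟧ℤ e f e≡f = ≡.trans (≡.sym (pos-⟦⟧ e)) (≡.trans (≡.cong +_ e≡f) (pos-⟦⟧ f))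

pos-∸ : ∀ {m n} → n ℕ.≤ m → + (m ℕ.∸ n) ≡ + m ℤ.- + n
pos-∸ {m} {n} n≤m = ≡.sym (≡.trans (ℤP.m-n≡m⊖n m n) (ℤP.⊖-≥ n≤m))

module ExprEvaluation {c ℓ} (R : CommutativeRing c ℓ) where
  open CommutativeRing R
  open FiniteSums R using (ι-+; ι-*)

  ⟦_⟧ : ℕExpr → Carrier
  ⟦ ⌜ x ⌝ ⟧ = ι R x
  ⟦ e ⊕ f ⟧ = ⟦ e ⟧ + ⟦ f ⟧
  ⟦ e ⊛ f ⟧ = ⟦ e ⟧ * ⟦ f ⟧

  ι-⟦⟧ : ∀ e → ι R ⟦ e ⟧ℕ ≈ ⟦ e ⟧
  ι-⟦⟧ ⌜ x ⌝   = refl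
  ι-⟦⟧ (e ⊕ f) = trans (ι-+ ⟦ e ⟧ℕ ⟦ f ⟧ℕ) (+-cong (ι-⟦⟧ e) (ι-⟦⟧ f))
  ι-⟦⟧ (e ⊛ f) = trans (ι-* ⟦ e ⟧ℕ ⟦ f ⟧ℕ) (*-cong (ι-⟦⟧ e) (ι-⟦⟧ f))

module RingSolver {c ℓ} (R : CommutativeRing c ℓ) where
  open CommutativeRing R hiding (zero)
  open FiniteSums R using (ι-+; ι-*)
  open import Relation.Binary.Reasoning.Setoid setoid
  open import Algebra.Properties.Ring ring using (-‿distribˡ-*; -‿distribʳ-*; -‿involutive; -0#≈0#)
  open import Algebra.Properties.AbelianGroup +-abelianGroup using (⁻¹-∙-comm)
  open import Algebra.Properties.CommutativeSemigroup +-commutativeSemigroup using (interchange)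

  -- The solver needs coefficients with a computable equality, so it works over ℤ mapped into R by ιℤ.
  ιℤ : ℤ → Carrier
  ιℤ (+ n)    = ι R n
  ιℤ -[1+ n ] = - ι R (suc n)

  ιℤ-neg : ∀ i → ιℤ (ℤ.- i) ≈ - ιℤ i
  ιℤ-neg (+ zero)  = sym -0#≈0#
  ιℤ-neg (+ suc n) = refl
  ιℤ-neg -[1+ n ]  = sym (-‿involutive _)

  ιℤ-⊖ : ∀ m n → ιℤ (m ℤ.⊖ n) ≈ ι R m - ι R n
  ιℤ-⊖ zero    zero    = sym (-‿inverseʳ 0#)
  ιℤ-⊖ (suc m) zero    = trans (sym (+-identityʳ _)) (+-congˡ (sym -0#≈0#))
  ιℤ-⊖ zero    (suc n) = sym (+-identityˡ _)
  ιℤ-⊖ (suc m) (suc n) = begin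
    ιℤ (suc m ℤ.⊖ suc n)              ≡⟨ ≡.cong ιℤ (ℤP.[1+m]⊖[1+n]≡m⊖n m n) ⟩
    ιℤ (m ℤ.⊖ n)                      ≈⟨ ιℤ-⊖ m n ⟩
    ι R m - ι R n                     ≈⟨ +-identityˡ _ ⟨
    0# + (ι R m - ι R n)              ≈⟨ +-congʳ (-‿inverseʳ 1#) ⟨
    (1# - 1#) + (ι R m - ι R n)       ≈⟨ interchange 1# (- 1#) (ι R m) (- ι R n) ⟩
    (1# + ι R m) + (- 1# - ι R n)     ≈⟨ +-congˡ (⁻¹-∙-comm 1# (ι R n)) ⟩
    (1# + ι R m) - (1# + ι R n)       ∎

  ιℤ-+ : ∀ i j → ιℤ (i ℤ.+ j) ≈ ιℤ i + ιℤ j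
  ιℤ-+ (+ m)    (+ n)    = ι-+ m n
  ιℤ-+ (+ m)    -[1+ n ] = ιℤ-⊖ m (suc n)
  ιℤ-+ -[1+ m ] (+ n)    = trans (ιℤ-⊖ n (suc m)) (+-comm _ _)
  ιℤ-+ -[1+ m ] -[1+ n ] = begin
    - ι R (suc (suc (m ℕ.+ n)))     ≡⟨ ≡.cong (λ k → - ι R (suc k)) (ℕP.+-suc m n) ⟨
    - ι R (suc m ℕ.+ suc n)         ≈⟨ -‿cong (ι-+ (suc m) (suc n)) ⟩
    - (ι R (suc m) + ι R (suc n))   ≈⟨ ⁻¹-∙-comm _ _ ⟨
    - ι R (suc m) + - ι R (suc n)   ∎

  ιℤ-*-pos : ∀ m n → ιℤ (+ m ℤ.* + n) ≈ ι R m * ι R n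
  ιℤ-*-pos m n = trans (reflexive (≡.cong ιℤ (≡.sym (ℤP.pos-* m n)))) (ι-* m n)

  ιℤ-* : ∀ i j → ιℤ (i ℤ.* j) ≈ ιℤ i * ιℤ j
  ιℤ-* (+ m)    (+ n)    = ιℤ-*-pos m n
  ιℤ-* (+ m)    -[1+ n ] = begin
    ιℤ (+ m ℤ.* ℤ.- + suc n)      ≡⟨ ≡.cong ιℤ (ℤP.neg-distribʳ-* (+ m) (+ suc n)) ⟨
    ιℤ (ℤ.- (+ m ℤ.* + suc n))    ≈⟨ ιℤ-neg (+ m ℤ.* + suc n) ⟩
    - ιℤ (+ m ℤ.* + suc n)        ≈⟨ -‿cong (ιℤ-*-pos m (suc n)) ⟩
    - (ι R m * ι R (suc n))       ≈⟨ -‿distribʳ-* _ _ ⟩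
    ι R m * - ι R (suc n)         ∎
  ιℤ-* -[1+ m ] (+ n)    = begin
    ιℤ (ℤ.- + suc m ℤ.* + n)      ≡⟨ ≡.cong ιℤ (ℤP.neg-distribˡ-* (+ suc m) (+ n)) ⟨
    ιℤ (ℤ.- (+ suc m ℤ.* + n))    ≈⟨ ιℤ-neg (+ suc m ℤ.* + n) ⟩
    - ιℤ (+ suc m ℤ.* + n)        ≈⟨ -‿cong (ιℤ-*-pos (suc m) n) ⟩
    - (ι R (suc m) * ι R n)       ≈⟨ -‿distribˡ-* _ _ ⟩
    - ι R (suc m) * ι R n         ∎
  ιℤ-* -[1+ m ] -[1+ n ] = begin
    ιℤ (+ suc m ℤ.* + suc n)          ≈⟨ ιℤ-*-pos (suc m) (suc n) ⟩
    ι R (suc m) * ι R (suc n)         ≈⟨ *-congʳ (-‿involutive _) ⟨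
    - - ι R (suc m) * ι R (suc n)     ≈⟨ -‿distribˡ-* _ _ ⟨
    - (- ι R (suc m) * ι R (suc n))   ≈⟨ -‿distribʳ-* _ _ ⟩
    - ι R (suc m) * - ι R (suc n)     ∎

  ιℤ-morphism : ℤ.+-*-rawRing -Raw-AlmostCommutative⟶ fromCommutativeRing R
  ιℤ-morphism = record
    { ⟦_⟧ = ιℤ ; +-homo = ιℤ-+ ; *-homo = ιℤ-* ; -‿homo = ιℤ-neg
    ; 0-homo = refl ; 1-homo = +-identityʳ 1# }

  ιℤ-≟ : ∀ i j → Maybe (ιℤ i ≈ ιℤ j)
  ιℤ-≟ i j with i ℤP.≟ j
  ... | yes i≡j = just (reflexive (≡.cong ιℤ i≡j))
  ... | no  _   = nothing

  open import Algebra.Solver.Ring ℤ.+-*-rawRing (fromCommutativeRing R) ιℤ-morphism ιℤ-≟ public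
    using (solve; _:+_; _:*_; _:-_; _:=_; con)

  -- Used with t = χ(D₁), X = χ(D), Y = χ(D⁻¹), y = χ(D₁⁻¹), l = λ, c = 2a, p = a + b, q = b − a.
  quadratic-vanishes : ∀ t X Y y l c p q B T →
                       t * Y ≈ t * y - l → y * X ≈ t * y - l → B * (X * Y) ≈ T →
                       p ≈ q + c → p * q ≈ B → T ≈ c * c * l →
                       l * ((c * t - p * X) * (c * t + q * X)) ≈ 0#
  quadratic-vanishes t X Y y l c p q B T tY≈ yX≈ BXY≈T p≈q+c pq≈B T≈ccl = begin
    l * ((c * t - p * X) * (c * t + q * X))
      ≈⟨ solve 6 (λ l c p q t X → l :* ((c :* t :- p :* X) :* (c :* t :+ q :* X))
                                := l :* c :* c :* (t :* t) :- l :* c :* (p :- q) :* (t :* X) :- l :* (p :* q) :* (X :* X))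
                 refl l c p q t X ⟩
    l * c * c * (t * t) - l * c * (p - q) * (t * X) - l * (p * q) * (X * X)
      ≈⟨ +-cong (+-congˡ (-‿cong (*-congʳ (*-congˡ p-q≈c)))) (-‿cong (*-congʳ (*-congˡ pq≈B))) ⟩
    l * c * c * (t * t) - l * c * c * (t * X) - l * B * (X * X)
      ≈⟨ solve 5 (λ l c B t X → l :* c :* c :* (t :* t) :- l :* c :* c :* (t :* X) :- l :* B :* (X :* X)
                                := c :* c :* l :* (t :* t :- t :* X) :- l :* B :* (X :* X))
                 refl l c B t X ⟩
    c * c * l * (t * t - t * X) - l * B * (X * X)
      ≈⟨ +-congʳ (*-congʳ (trans (sym T≈ccl) (sym BXY≈T))) ⟩
    B * (X * Y) * (t * t - t * X) - l * B * (X * X)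
      ≈⟨ solve 5 (λ B X Y t l → B :* (X :* Y) :* (t :* t :- t :* X) :- l :* B :* (X :* X)
                                := B :* X :* (t :* (t :* Y) :- X :* (t :* Y) :- l :* X))
                 refl B X Y t l ⟩
    B * X * (t * (t * Y) - X * (t * Y) - l * X)
      ≈⟨ *-congˡ (+-congʳ (+-cong (*-congˡ (trans tY≈ (sym yX≈))) (-‿cong (*-congˡ tY≈)))) ⟩
    B * X * (t * (y * X) - X * (t * y - l) - l * X)
      ≈⟨ solve 5 (λ B X t y l → B :* X :* (t :* (y :* X) :- X :* (t :* y :- l) :- l :* X) := con (+ 0))
                 refl B X t y l ⟩
    0# ∎
    where
    p-q≈c : p - q ≈ c
    p-q≈c = trans (+-congʳ p≈q+c) (trans (+-congʳ (+-comm q c)) (trans (+-assoc c q (- q)) (trans (+-congˡ (-‿inverseʳ q)) (+-identityʳ c))))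

module Char0Domain {c ℓ} (K : CommutativeRing c ℓ) (dom : IsChar0DecDomain K) where
  open CommutativeRing K
  open IsChar0DecDomain dom
  open FiniteSums K using (ι-+)
  open ExprEvaluation K using (⟦_⟧; ι-⟦⟧)
  open import Relation.Binary.Reasoning.Setoid setoid
  open import Algebra.Properties.Group +-group using (x∙y⁻¹≈ε⇒x≈y; x≈y⇒x∙y⁻¹≈ε)
  open import Algebra.Properties.Ring ring using (x[y-z]≈xy-xz; [y-z]x≈yx-zx)

  +-cancelˡ-0 : ∀ x y → x + y ≈ x → y ≈ 0#
  +-cancelˡ-0 x y x+y≈x = begin
    y              ≈⟨ +-identityˡ y ⟨
    0# + y         ≈⟨ +-congʳ (-‿inverseˡ x) ⟨
    (- x + x) + y  ≈⟨ +-assoc _ _ _ ⟩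
    - x + (x + y)  ≈⟨ +-congˡ x+y≈x ⟩
    - x + x        ≈⟨ -‿inverseˡ x ⟩
    0#             ∎

  ι-mono : ∀ {m n} → m ℕ.≤ n → ι K m ≈ ι K n → m ≡ n
  ι-mono {m} {n} m≤n ιm≈ιn = ≡.trans (≡.sym (ℕP.+-identityʳ m)) (≡.trans (≡.cong (m ℕ.+_) (≡.sym d≡0)) n≡m+d)
    where
    n≡m+d : m ℕ.+ (n ℕ.∸ m) ≡ n
    n≡m+d = ℕP.m+[n∸m]≡n m≤n
    d≡0 : n ℕ.∸ m ≡ 0
    d≡0 = char0 _ (+-cancelˡ-0 (ι K m) _ (trans (sym (ι-+ m (n ℕ.∸ m))) (trans (reflexive (≡.cong (ι K) n≡m+d)) (sym ιm≈ιn))))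

  ι-injective : ∀ m n → ι K m ≈ ι K n → m ≡ n
  ι-injective m n ιm≈ιn with ℕP.≤-total m n
  ... | inj₁ m≤n = ι-mono m≤n ιm≈ιn
  ... | inj₂ n≤m = ≡.sym (ι-mono n≤m (sym ιm≈ιn))

  ι≉0 : ∀ {n} → 0 ℕ.< n → ¬ ι K n ≈ 0#
  ι≉0 0<n ιn≈0 = ℕP.<⇒≢ 0<n (≡.sym (char0 _ ιn≈0))

  *-cancelˡ : ∀ x y z → ¬ x ≈ 0# → x * y ≈ x * z → y ≈ z
  *-cancelˡ x y z x≉0 xy≈xz with no-zero-divisors x (y - z) (trans (x[y-z]≈xy-xz x y z) (x≈y⇒x∙y⁻¹≈ε xy≈xz))
  ... | inj₁ x≈0   = contradiction x≈0 x≉0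
  ... | inj₂ y-z≈0 = x∙y⁻¹≈ε⇒x≈y y z y-z≈0

  ⟦⟧-injective : ∀ e f → ⟦ e ⟧ ≈ ⟦ f ⟧ → ⟦ e ⟧ℤ ≡ ⟦ f ⟧ℤ
  ⟦⟧-injective e f e≈f = ≡.trans (≡.sym (pos-⟦⟧ e))
    (≡.trans (≡.cong +_ (ι-injective _ _ (trans (ι-⟦⟧ e) (trans e≈f (sym (ι-⟦⟧ f)))))) (pos-⟦⟧ f))

  *-≉0 : ∀ {x y} → ¬ x ≈ 0# → ¬ y ≈ 0# → ¬ x * y ≈ 0#
  *-≉0 x≉0 y≉0 xy≈0 = [ x≉0 , y≉0 ]′ (no-zero-divisors _ _ xy≈0)

  fixed⇒0 : ∀ x y → ¬ x ≈ 1# → x * y ≈ y → y ≈ 0#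
  fixed⇒0 x y x≉1 xy≈y = sym (*-cancelˡ (x - 1#) 0# y (x≉1 ∘ x∙y⁻¹≈ε⇒x≈y x 1#) (begin
    (x - 1#) * 0#     ≈⟨ zeroʳ _ ⟩
    0#                ≈⟨ x≈y⇒x∙y⁻¹≈ε xy≈y ⟨
    x * y - y         ≈⟨ +-congˡ (-‿cong (*-identityˡ y)) ⟨
    x * y - 1# * y    ≈⟨ [y-z]x≈yx-zx y x 1# ⟨
    (x - 1#) * y      ∎))

module Characters {c ℓ c' ℓ'} (G : FiniteAbelianGroup c ℓ) (K : CommutativeRing c' ℓ') (dom : IsChar0DecDomain K) where
  module G = FiniteAbelianGroup G
  open CommutativeRing K
  open IsChar0DecDomain dom
  open FiniteSums K
  open Char0Domain K dom
  open import Relation.Binary.Reasoning.Setoid setoid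
  import Algebra.Properties.Group G.group as GP
  import Algebra.Properties.AbelianGroup G.abGroup as GAP
  open import Algebra.Properties.CommutativeSemigroup *-commutativeSemigroup using (interchange)
  open import Algebra.Properties.Ring ring using ([y-z]x≈yx-zx)

  Char : Set (c ⊔ ℓ ⊔ c' ⊔ ℓ')
  Char = Character G K

  trivial : Char
  trivial = record
    { χ = λ _ → 1# ; χ-cong = λ _ → refl ; χ-hom = λ _ _ → sym (*-identityˡ 1#) ; χ-ε = refl }

  _·_ : Char → Char → Char
  ψ · φ = record
    { χ      = λ g → χ ψ g * χ φ g
    ; χ-cong = λ x≈y → *-cong (χ-cong ψ x≈y) (χ-cong φ x≈y)
    ; χ-hom  = λ x y → trans (*-cong (χ-hom ψ x y) (χ-hom φ x y)) (interchange _ _ _ _)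
    ; χ-ε    = trans (*-cong (χ-ε ψ) (χ-ε φ)) (*-identityˡ 1#)
    }

  χ-ε⁻¹ : ∀ (ψ : Char) → χ ψ (G.ε G.⁻¹) ≈ 1#
  χ-ε⁻¹ ψ = trans (χ-cong ψ GP.ε⁻¹≈ε) (χ-ε ψ)

  conj : Char → Char
  conj ψ = record
    { χ      = λ g → χ ψ (g G.⁻¹)
    ; χ-cong = λ x≈y → χ-cong ψ (G.⁻¹-cong x≈y)
    ; χ-hom  = λ x y → trans (χ-cong ψ (G.trans (G.⁻¹-cong (G.comm x y)) (G.sym (GAP.⁻¹-∙-comm y x))))
                             (trans (χ-hom ψ (y G.⁻¹) (x G.⁻¹)) (*-comm _ _))
    ; χ-ε    = χ-ε⁻¹ ψ
    }

  χ-inverseʳ : ∀ (ψ : Char) g → χ ψ g * χ ψ (g G.⁻¹) ≈ 1#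
  χ-inverseʳ ψ g = begin
    χ ψ g * χ ψ (g G.⁻¹)  ≈⟨ χ-hom ψ g (g G.⁻¹) ⟨
    χ ψ (g G.∙ g G.⁻¹)    ≈⟨ χ-cong ψ (G.inverseʳ g) ⟩
    χ ψ G.ε               ≈⟨ χ-ε ψ ⟩
    1#                    ∎

  conj-principal : ∀ (ψ : Char) → Principal G K (conj ψ) → Principal G K ψ
  conj-principal ψ pr g = trans (χ-cong ψ (G.sym (GP.⁻¹-involutive g))) (pr (g G.⁻¹))

  elems-cover : ∀ g → ∃ λ x → x ∈ G.elems × x G.≈ g
  elems-cover g = let x , x∈ , x≟g = cnt-pos⇒witness _ G.elems (G.elems-enum g) in x , x∈ , witness (x G.≟ g) x≟g

  nontrivialValue? : ∀ (ψ : Char) → Dec (Any (λ g → ¬ χ ψ g ≈ 1#) G.elems)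
  nontrivialValue? ψ = any? (λ g → ¬? (χ ψ g ≈? 1#)) G.elems

  nonPrincipal⇒nontrivialValue : ∀ (ψ : Char) → ¬ Principal G K ψ → Any (λ g → ¬ χ ψ g ≈ 1#) G.elems
  nonPrincipal⇒nontrivialValue ψ ¬pr with nontrivialValue? ψ
  ... | yes some = some
  ... | no  none = contradiction principal ¬pr
    where
    principal : Principal G K ψ
    principal g = let x , x∈ , x≈g = elems-cover g in
      trans (χ-cong ψ (G.sym x≈g)) (decidable-stable (χ ψ x ≈? 1#) (All.lookup (¬Any⇒All¬ G.elems none) x∈))

  nonPrincipal? : ∀ (ψ : Char) → Dec (¬ Principal G K ψ)
  nonPrincipal? ψ = map′ (λ some pr → let _ , χg≉1 = Any.satisfied some in χg≉1 (pr _))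
                         (nonPrincipal⇒nontrivialValue ψ) (nontrivialValue? ψ)

  nonPrincipal⇒witness : ∀ (ψ : Char) → ¬ Principal G K ψ → ∃ λ g → ¬ χ ψ g ≈ 1#
  nonPrincipal⇒witness ψ = Any.satisfied ∘ nonPrincipal⇒nontrivialValue ψ

  ∑-elems-δ : ∀ z (f : G.Carrier → Carrier) → (∀ {x y} → x G.≈ y → f x ≈ f y) →
              ∑ (λ x → 𝟙 (does (z G.≟ x)) * f x) G.elems ≈ f z
  ∑-elems-δ z f f-cong = trans
    (∑-cong (λ x → *-congʳ (reflexive (≡.cong 𝟙 (does-cong G.sym G.sym (z G.≟ x) (x G.≟ z))))) G.elems)
    (∑-δ-unique G._≟_ z f (λ _ → f-cong) G.elems (G.elems-enum z))

  ∑-elems-translate : ∀ h (f : G.Carrier → Carrier) → (∀ {x y} → x G.≈ y → f x ≈ f y) →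
                      ∑ (λ x → f (h G.∙ x)) G.elems ≈ ∑ f G.elems
  ∑-elems-translate h f f-cong = begin
    ∑ (λ x → f (h G.∙ x)) E                                 ≈⟨ ∑-cong (λ x → ∑-elems-δ (h G.∙ x) f f-cong) E ⟨
    ∑ (λ x → ∑ (λ y → 𝟙 (does ((h G.∙ x) G.≟ y)) * f y) E) E  ≈⟨ ∑-comm _ E E ⟩
    ∑ (λ y → ∑ (λ x → 𝟙 (does ((h G.∙ x) G.≟ y)) * f y) E) E  ≈⟨ ∑-cong (λ y → ∑-indicator _ (f y) E) E ⟩
    ∑ (λ y → ι K (cnt (λ x → does ((h G.∙ x) G.≟ y)) E) * f y) E
      ≈⟨ ∑-cong (λ y → trans (*-congʳ (trans (reflexive (≡.cong (ι K) (once y))) ι-1)) (*-identityˡ (f y))) E ⟩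
    ∑ f E                                                   ∎
    where
    E : List G.Carrier
    E = G.elems
    once : ∀ y → cnt (λ x → does ((h G.∙ x) G.≟ y)) E ≡ 1
    once y = ≡.trans (cnt-cong (λ x → does-cong to from ((h G.∙ x) G.≟ y) (x G.≟ (h G.⁻¹ G.∙ y))) E)
                     (G.elems-enum (h G.⁻¹ G.∙ y))
      where
      to : ∀ {x} → h G.∙ x G.≈ y → x G.≈ h G.⁻¹ G.∙ y
      to {x} hx≈y = G.trans (G.sym (GP.\\-leftDividesʳ h x)) (G.∙-congˡ hx≈y)
      from : ∀ {x} → x G.≈ h G.⁻¹ G.∙ y → h G.∙ x G.≈ y
      from x≈h⁻¹y = G.trans (G.∙-congˡ x≈h⁻¹y) (GP.\\-leftDividesˡ h y)

  ∑-punctured : ∀ (ψ : Char) → ∑ (λ g → (1# - 𝟙 (does (G.ε G.≟ g))) * χ ψ g) G.elems ≈ ∑ (χ ψ) G.elems - 1#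
  ∑-punctured ψ = begin
    ∑ (λ g → (1# - 𝟙 (does (G.ε G.≟ g))) * χ ψ g) G.elems
      ≈⟨ ∑-cong (λ g → trans ([y-z]x≈yx-zx _ 1# _) (+-congʳ (*-identityˡ _))) G.elems ⟩
    ∑ (λ g → χ ψ g - 𝟙 (does (G.ε G.≟ g)) * χ ψ g) G.elems
      ≈⟨ trans (∑-+ _ _ G.elems) (+-congˡ (∑-neg _ G.elems)) ⟩
    ∑ (χ ψ) G.elems - ∑ (λ g → 𝟙 (does (G.ε G.≟ g)) * χ ψ g) G.elems
      ≈⟨ +-congˡ (-‿cong (trans (∑-elems-δ G.ε (χ ψ) (χ-cong ψ)) (χ-ε ψ))) ⟩
    ∑ (χ ψ) G.elems - 1# ∎

  χΣ-principal : ∀ (ψ : Char) → Principal G K ψ → ∀ xs → χΣ G K ψ xs ≈ ι K (length xs)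
  χΣ-principal ψ pr xs = trans (∑-cong pr xs) (trans (∑-const 1# xs) (*-identityʳ _))

  χΣinv-principal : ∀ (ψ : Char) → Principal G K ψ → ∀ xs → χΣinv G K ψ xs ≈ ι K (length xs)
  χΣinv-principal ψ pr xs = trans (∑-cong (pr ∘ G._⁻¹) xs) (trans (∑-const 1# xs) (*-identityʳ _))

  ∑-nonprincipal : ∀ (ψ : Char) → ¬ Principal G K ψ → ∑ (χ ψ) G.elems ≈ 0#
  ∑-nonprincipal ψ ¬pr = let g , χg≉1 = nonPrincipal⇒witness ψ ¬pr in
    fixed⇒0 (χ ψ g) _ χg≉1 (begin
      χ ψ g * ∑ (χ ψ) G.elems         ≈⟨ *-distribˡ-∑ (χ ψ g) (χ ψ) G.elems ⟩
      ∑ (λ x → χ ψ g * χ ψ x) G.elems ≈⟨ ∑-cong (λ x → χ-hom ψ g x) G.elems ⟨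
      ∑ (λ x → χ ψ (g G.∙ x)) G.elems ≈⟨ ∑-elems-translate g (χ ψ) (χ-cong ψ) ⟩
      ∑ (χ ψ) G.elems                 ∎)

  two-distinct : ∀ xs → (∀ g → G.mult g xs ℕ.≤ 1) → 2 ℕ.≤ length xs →
                 ∃ λ x → ∃ λ y → x ∈ xs × y ∈ xs × ¬ x G.≈ y
  two-distinct (x ∷ y ∷ xs) mult≤1 _ = x , y , here ≡.refl , there (here ≡.refl) ,
    λ x≈y → ℕP.<⇒≱ (twice x≈y) (mult≤1 x)
    where
    twice : x G.≈ y → 2 ℕ.≤ G.mult x (x ∷ y ∷ xs)
    twice x≈y rewrite dec-true (x G.≟ x) G.refl | dec-true (y G.≟ x) (G.sym x≈y) = s≤s (s≤s z≤n)
  two-distinct (_ ∷ []) _ (s≤s ())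

  0<order : 0 ℕ.< G.order
  0<order with G.elems | G.elems-enum G.ε
  ... | _ ∷ _ | _ = s≤s z≤n

  quot : G.Carrier × G.Carrier → G.Carrier
  quot p = proj₁ p G.∙ proj₂ p G.⁻¹

  χΣ-*-χΣinv : ∀ (ψ : Char) xs ys → χΣ G K ψ xs * χΣinv G K ψ ys ≈ ∑ (χ ψ ∘ quot) (cartesianProduct xs ys)
  χΣ-*-χΣinv ψ []       ys = zeroˡ _
  χΣ-*-χΣinv ψ (x ∷ xs) ys = begin
    (χ ψ x + χΣ G K ψ xs) * χΣinv G K ψ ys
      ≈⟨ distribʳ _ _ _ ⟩
    χ ψ x * χΣinv G K ψ ys + χΣ G K ψ xs * χΣinv G K ψ ys
      ≈⟨ +-cong row (χΣ-*-χΣinv ψ xs ys) ⟩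
    ∑ (χ ψ ∘ quot) (map (x ,_) ys) + ∑ (χ ψ ∘ quot) (cartesianProduct xs ys)
      ≈⟨ ∑-++ (χ ψ ∘ quot) (map (x ,_) ys) (cartesianProduct xs ys) ⟨
    ∑ (χ ψ ∘ quot) (cartesianProduct (x ∷ xs) ys) ∎
    where
    row : χ ψ x * χΣinv G K ψ ys ≈ ∑ (χ ψ ∘ quot) (map (x ,_) ys)
    row = trans (*-distribˡ-∑ _ _ ys) (trans (∑-cong (λ y → sym (χ-hom ψ x (y G.⁻¹))) ys) (sym (∑-map (χ ψ ∘ quot) (x ,_) ys)))

  ∑-regroup : ∀ (q : A → G.Carrier) (f : G.Carrier → Carrier) → (∀ {x y} → x G.≈ y → f x ≈ f y) → ∀ xs →
              ∑ (f ∘ q) xs ≈ ∑ (λ g → ι K (cnt (λ x → does (q x G.≟ g)) xs) * f g) G.elems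
  ∑-regroup q f f-cong xs = begin
    ∑ (f ∘ q) xs                                                    ≈⟨ ∑-cong (λ x → ∑-elems-δ (q x) f f-cong) xs ⟨
    ∑ (λ x → ∑ (λ g → 𝟙 (does (q x G.≟ g)) * f g) G.elems) xs        ≈⟨ ∑-comm _ xs G.elems ⟩
    ∑ (λ g → ∑ (λ x → 𝟙 (does (q x G.≟ g)) * f g) xs) G.elems        ≈⟨ ∑-cong (λ g → ∑-indicator _ (f g) xs) G.elems ⟩
    ∑ (λ g → ι K (cnt (λ x → does (q x G.≟ g)) xs) * f g) G.elems    ∎

module CharacterGroup {c ℓ c' ℓ'} (G : FiniteAbelianGroup c ℓ) (K : CommutativeRing c' ℓ') (dom : IsChar0DecDomain K)
                      (n : ℕ) (chars : Fin n → Character G K) (cg : IsCharacterGroup G K n chars)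
                      (n≡v : n ≡ FiniteAbelianGroup.order G) where
  open Characters G K dom public
  open CommutativeRing K
  open IsChar0DecDomain dom
  open IsCharacterGroup cg
  open FiniteSums K
  open Char0Domain K dom
  open import Relation.Binary.Reasoning.Setoid setoid
  import Algebra.Properties.Group G.group as GP

  ∑Ĝ : (Fin n → Carrier) → Carrier
  ∑Ĝ f = ∑ f (allFin n)

  index : Char → Fin n
  index ψ = proj₁ (complete ψ)

  χ-index : ∀ (ψ : Char) g → χ (chars (index ψ)) g ≈ χ ψ g
  χ-index ψ = proj₂ (complete ψ)

  trivialIndex : Fin n
  trivialIndex = index trivial

  principal-trivialIndex : Principal G K (chars trivialIndex)
  principal-trivialIndex = χ-index trivial

  principal⇒trivialIndex : ∀ i → Principal G K (chars i) → i ≡ trivialIndex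
  principal⇒trivialIndex i pr = injective i trivialIndex (λ g → trans (pr g) (sym (principal-trivialIndex g)))

  mul : Char → Fin n → Fin n
  mul ψ i = index (ψ · chars i)

  mul-cancel : ∀ (ψ φ : Char) → (∀ g → χ ψ g * χ φ g ≈ 1#) → ∀ i → mul ψ (mul φ i) ≡ i
  mul-cancel ψ φ ψφ≈1 i = injective _ i λ g → begin
    χ (chars (mul ψ (mul φ i))) g     ≈⟨ χ-index (ψ · chars (mul φ i)) g ⟩
    χ ψ g * χ (chars (mul φ i)) g     ≈⟨ *-congˡ (χ-index (φ · chars i) g) ⟩
    χ ψ g * (χ φ g * χ (chars i) g)   ≈⟨ *-assoc _ _ _ ⟨
    (χ ψ g * χ φ g) * χ (chars i) g   ≈⟨ *-congʳ (ψφ≈1 g) ⟩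
    1# * χ (chars i) g                ≈⟨ *-identityˡ _ ⟩
    χ (chars i) g                     ∎

  multiplication : Char → Permutation′ n
  multiplication ψ = permutation (mul ψ) (mul (conj ψ))
    (mul-cancel ψ (conj ψ) (χ-inverseʳ ψ))
    (mul-cancel (conj ψ) ψ (λ g → trans (*-comm _ _) (χ-inverseʳ ψ g)))

  columnSum : G.Carrier → Carrier
  columnSum g = ∑Ĝ (λ i → χ (chars i) g)

  columnSum-invariant : ∀ (ψ : Char) g → χ ψ g * columnSum g ≈ columnSum g
  columnSum-invariant ψ g = begin
    χ ψ g * columnSum g                        ≈⟨ *-distribˡ-∑ _ _ (allFin n) ⟩
    ∑Ĝ (λ i → χ (ψ · chars i) g)               ≈⟨ ∑-cong (λ i → χ-index (ψ · chars i) g) (allFin n) ⟨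
    ∑Ĝ (λ i → χ (chars (mul ψ i)) g)           ≈⟨ ∑-allFin-permute (λ i → χ (chars i) g) (multiplication ψ) ⟩
    columnSum g                                ∎

  inKernel : G.Carrier → Bool
  inKernel g = does (all? (λ i → χ (chars i) g ≈? 1#) (allFin n))

  columnSum-kernel : ∀ g → columnSum g ≈ 𝟙 (inKernel g) * ι K n
  columnSum-kernel g with all? (λ i → χ (chars i) g ≈? 1#) (allFin n)
  ... | yes all≈1 = begin
    columnSum g              ≈⟨ ∑-cong (λ i → All.lookup all≈1 (∈-allFin i)) (allFin n) ⟩
    ∑Ĝ (λ _ → 1#)            ≈⟨ ∑-const 1# (allFin n) ⟩
    ι K (length (allFin n)) * 1# ≡⟨ ≡.cong (λ k → ι K k * 1#) (length-allFin n) ⟩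
    ι K n * 1#               ≈⟨ *-comm _ _ ⟩
    1# * ι K n               ∎
  ... | no ¬all = let i , χg≉1 = Any.satisfied (¬All⇒Any¬ (λ i → χ (chars i) g ≈? 1#) (allFin n) ¬all) in
    trans (fixed⇒0 _ _ χg≉1 (columnSum-invariant (chars i) g)) (sym (zeroˡ _))

  ∑-columnSum : ∑ columnSum G.elems ≈ ι K G.order
  ∑-columnSum = begin
    ∑ columnSum G.elems                           ≈⟨ ∑-comm (λ g i → χ (chars i) g) G.elems (allFin n) ⟩
    ∑Ĝ (λ i → ∑ (χ (chars i)) G.elems)            ≈⟨ ∑-cong row (allFin n) ⟩
    ∑Ĝ (λ i → 𝟙 (does (i FinP.≟ trivialIndex)) * ι K G.order) ≈⟨ ∑-allFin-δ trivialIndex (λ _ → ι K G.order) ⟩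
    ι K G.order                                   ∎
    where
    row : ∀ i → ∑ (χ (chars i)) G.elems ≈ 𝟙 (does (i FinP.≟ trivialIndex)) * ι K G.order
    row i with i FinP.≟ trivialIndex
    ... | yes ≡.refl = trans (χΣ-principal (chars trivialIndex) principal-trivialIndex G.elems) (sym (*-identityˡ _))
    ... | no  i≢i₀   = trans (∑-nonprincipal (chars i) (i≢i₀ ∘ principal⇒trivialIndex i)) (sym (zeroˡ _))

  -- ∑_g columnSum g = v, while columnSum g is n on the common kernel of Ĝ and 0 off it.
  kernel-size : cnt inKernel G.elems ≡ 1
  kernel-size = ι-injective _ 1 (*-cancelˡ (ι K n) _ _ (ι≉0 0<n) (begin
    ι K n * ι K (cnt inKernel G.elems)                ≈⟨ *-congˡ (ι-cnt inKernel G.elems) ⟩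
    ι K n * ∑ (𝟙 ∘ inKernel) G.elems                  ≈⟨ *-comm _ _ ⟩
    ∑ (𝟙 ∘ inKernel) G.elems * ι K n                  ≈⟨ *-distribʳ-∑ _ _ G.elems ⟩
    ∑ (λ g → 𝟙 (inKernel g) * ι K n) G.elems          ≈⟨ ∑-cong columnSum-kernel G.elems ⟨
    ∑ columnSum G.elems                               ≈⟨ ∑-columnSum ⟩
    ι K G.order                                       ≡⟨ ≡.cong (ι K) n≡v ⟨
    ι K n                                             ≈⟨ trans (*-congˡ ι-1) (*-identityʳ _) ⟨
    ι K n * ι K 1                                     ∎))
    where
    0<n : 0 ℕ.< n
    0<n = ≡.subst (0 ℕ.<_) (≡.sym n≡v) 0<order

  kernel-ε : ∀ {x} → x G.≈ G.ε → inKernel x ≡ true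
  kernel-ε x≈ε = dec-true (all? _ (allFin n)) (All.tabulate λ {i} _ → trans (χ-cong (chars i) x≈ε) (χ-ε (chars i)))

  kernel-trivial : ∀ g → ¬ g G.≈ G.ε → inKernel g ≡ false
  kernel-trivial g g≉ε = ¬-not λ g∈ker → ℕP.<⇒≱ (s≤s (s≤s z≤n)) (≡.subst (2 ℕ.≤_) kernel-size (≡.subst (ℕ._≤ cnt inKernel G.elems)
    (≡.cong₂ ℕ._+_ (G.elems-enum G.ε) (G.elems-enum g))
    (cnt-disjoint inKernel _ _ (λ x x≟ε → kernel-ε (witness (x G.≟ G.ε) x≟ε)) (λ x x≟g → ∈ker x (witness (x G.≟ g) x≟g) g∈ker)
                  (λ x x≟ε → dec-false (x G.≟ g) (λ x≈g → g≉ε (G.trans (G.sym x≈g) (witness (x G.≟ G.ε) x≟ε)))) G.elems)))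
    where
    ∈ker : ∀ x → x G.≈ g → inKernel g ≡ true → inKernel x ≡ true
    ∈ker x x≈g g∈ker = dec-true (all? _ (allFin n)) (All.tabulate λ {i} _ →
      trans (χ-cong (chars i) x≈g) (All.lookup (witness (all? _ (allFin n)) g∈ker) (∈-allFin i)))

  dual-orthogonality : ∀ g → columnSum g ≈ ι K n * 𝟙 (does (g G.≟ G.ε))
  dual-orthogonality g with g G.≟ G.ε
  ... | yes g≈ε = trans (columnSum-kernel g) (trans (*-congʳ (reflexive (≡.cong 𝟙 (kernel-ε g≈ε)))) (*-comm _ _))
  ... | no  g≉ε = trans (columnSum-kernel g) (trans (*-congʳ (reflexive (≡.cong 𝟙 (kernel-trivial g g≉ε))))
                                                     (trans (zeroˡ _) (sym (zeroʳ _))))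

  fourier-count : ∀ xs ys g →
    ∑Ĝ (λ i → (χΣ G K (chars i) xs * χΣinv G K (chars i) ys) * χ (chars i) (g G.⁻¹))
      ≈ ι K n * ι K (cnt (λ p → does (quot p G.≟ g)) (cartesianProduct xs ys))
  fourier-count xs ys g = begin
    ∑Ĝ (λ i → (χΣ G K (chars i) xs * χΣinv G K (chars i) ys) * χ (chars i) (g G.⁻¹))
      ≈⟨ ∑-cong (λ i → trans (*-congʳ (χΣ-*-χΣinv (chars i) xs ys)) (*-distribʳ-∑ _ _ L)) (allFin n) ⟩
    ∑Ĝ (λ i → ∑ (λ p → χ (chars i) (quot p) * χ (chars i) (g G.⁻¹)) L)
      ≈⟨ ∑-cong (λ i → ∑-cong (λ p → χ-hom (chars i) (quot p) (g G.⁻¹)) L) (allFin n) ⟨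
    ∑Ĝ (λ i → ∑ (λ p → χ (chars i) (quot p G.∙ g G.⁻¹)) L)
      ≈⟨ ∑-comm _ (allFin n) L ⟩
    ∑ (λ p → columnSum (quot p G.∙ g G.⁻¹)) L
      ≈⟨ ∑-cong (λ p → dual-orthogonality (quot p G.∙ g G.⁻¹)) L ⟩
    ∑ (λ p → ι K n * 𝟙 (does ((quot p G.∙ g G.⁻¹) G.≟ G.ε))) L
      ≈⟨ *-distribˡ-∑ _ _ L ⟨
    ι K n * ∑ (λ p → 𝟙 (does ((quot p G.∙ g G.⁻¹) G.≟ G.ε))) L
      ≈⟨ *-congˡ (∑-cong (λ p → reflexive (≡.cong 𝟙 (quot≈g p))) L) ⟩
    ι K n * ∑ (λ p → 𝟙 (does (quot p G.≟ g))) L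
      ≈⟨ *-congˡ (ι-cnt _ L) ⟨
    ι K n * ι K (cnt (λ p → does (quot p G.≟ g)) L) ∎
    where
    L : List (G.Carrier × G.Carrier)
    L = cartesianProduct xs ys
    quot≈g : ∀ p → does ((quot p G.∙ g G.⁻¹) G.≟ G.ε) ≡ does (quot p G.≟ g)
    quot≈g p = does-cong (GP.x∙y⁻¹≈ε⇒x≈y _ g) GP.x≈y⇒x∙y⁻¹≈ε ((quot p G.∙ g G.⁻¹) G.≟ G.ε) (quot p G.≟ g)

module SEDFCharacters {c ℓ c' ℓ'} (G : FiniteAbelianGroup c ℓ) (K : CommutativeRing c' ℓ') (dom : IsChar0DecDomain K)
                      (n : ℕ) (chars : Fin n → Character G K) (cg : IsCharacterGroup G K n chars)
                      (n≡v : n ≡ FiniteAbelianGroup.order G)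
                      (m k lam : ℕ) (Ds : Fin m → List (FiniteAbelianGroup.Carrier G)) (sedf : IsSEDF G m k lam Ds) where
  open CharacterGroup G K dom n chars cg n≡v public
  open CommutativeRing K
  open IsSEDF sedf
  open FiniteSums K
  open Char0Domain K dom
  open import Relation.Binary.Reasoning.Setoid setoid
  open import Algebra.Properties.Ring ring using (-0#≈0#; -‿distribʳ-*)
  import Algebra.Properties.Group G.group as GP
  open RingSolver K using (solve; _:+_; _:*_; _:-_; _:=_)

  zeroIf : Bool → Carrier → Carrier
  zeroIf b x = if b then 0# else x

  zeroIf-cong : ∀ b {x y} → x ≈ y → zeroIf b x ≈ zeroIf b y
  zeroIf-cong true  _   = refl
  zeroIf-cong false x≈y = x≈y

  *-zeroIf : ∀ b x y → x * zeroIf b y ≈ zeroIf b (x * y)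
  *-zeroIf true  x y = zeroʳ x
  *-zeroIf false x y = refl

  zeroIf-* : ∀ b x y → zeroIf b x * y ≈ zeroIf b (x * y)
  zeroIf-* true  x y = zeroˡ y
  zeroIf-* false x y = refl

  zeroIf-∑ : ∀ b (f : A → Carrier) xs → zeroIf b (∑ f xs) ≈ ∑ (zeroIf b ∘ f) xs
  zeroIf-∑ true  f xs = sym (∑-0 xs)
  zeroIf-∑ false f xs = refl

  ι-zeroIf : ∀ b x → ι K (if b then 0 else x) ≈ zeroIf b (ι K x)
  ι-zeroIf true  x = refl
  ι-zeroIf false x = refl

  ∑-others : (Fin m → Carrier) → Fin m → Carrier
  ∑-others f j = ∑ (λ i → zeroIf (does (i FinP.≟ j)) (f i)) (allFin m)

  ∑-split : ∀ j (f : Fin m → Carrier) → ∑ f (allFin m) ≈ f j + ∑-others f j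
  ∑-split j f = trans (∑-cong split-at (allFin m)) (trans (∑-+ _ _ (allFin m)) (+-congʳ (∑-allFin-δ j f)))
    where
    split-at : ∀ i → f i ≈ 𝟙 (does (i FinP.≟ j)) * f i + zeroIf (does (i FinP.≟ j)) (f i)
    split-at i with does (i FinP.≟ j)
    ... | true  = sym (trans (+-identityʳ _) (*-identityˡ _))
    ... | false = sym (trans (+-congʳ (zeroˡ _)) (+-identityˡ _))

  pairCount : Fin m → Fin m → G.Carrier → ℕ
  pairCount j i g = cnt (λ p → does (quot p G.≟ g)) (cartesianProduct (Ds j) (Ds i))

  ι-sedfCoeff : ∀ j g → ι K (sedfCoeff G m Ds j g) ≈ ∑-others (λ i → ι K (pairCount j i g)) j
  ι-sedfCoeff j g = trans (ι-foldr _ (allFin m)) (∑-cong (λ i → ι-zeroIf (does (i FinP.≟ j)) (pairCount j i g)) (allFin m))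

  sedfCoeff-cong : ∀ j {g h} → g G.≈ h → sedfCoeff G m Ds j g ≡ sedfCoeff G m Ds j h
  sedfCoeff-cong j {g} {h} g≈h = ListP.foldr-cong (λ i r → ≡.cong (ℕ._+ r) (term i)) ≡.refl (allFin m)
    where
    term : ∀ i → (if does (i FinP.≟ j) then 0 else cnt (λ p → does (quot p G.≟ g)) (cartesianProduct (Ds j) (Ds i)))
               ≡ (if does (i FinP.≟ j) then 0 else cnt (λ p → does (quot p G.≟ h)) (cartesianProduct (Ds j) (Ds i)))
    term i with does (i FinP.≟ j)
    ... | true  = ≡.refl
    ... | false = cnt-cong (λ p → does-cong (λ q≈g → G.trans q≈g g≈h) (λ q≈h → G.trans q≈h (G.sym g≈h))
                                            (quot p G.≟ g) (quot p G.≟ h)) (cartesianProduct (Ds j) (Ds i))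

  sedfCoeff≈ : ∀ j g → ι K (sedfCoeff G m Ds j g) ≈ ι K lam * (1# - 𝟙 (does (G.ε G.≟ g)))
  sedfCoeff≈ j g with G.ε G.≟ g
  ... | yes ε≈g = trans (reflexive (≡.cong (ι K) (≡.trans (sedfCoeff-cong j (G.sym ε≈g)) (coeff-1 j))))
                        (sym (trans (*-congˡ (-‿inverseʳ 1#)) (zeroʳ _)))
  ... | no  ε≉g = trans (reflexive (≡.cong (ι K) (coeff-g j g (ε≉g ∘ G.sym))))
                        (sym (trans (*-congˡ (trans (+-congˡ -0#≈0#) (+-identityʳ 1#))) (*-identityʳ _)))

  χD-others : Char → Fin m → Carrier
  χD-others ψ = ∑-others (λ i → χΣ G K ψ (Ds i))

  χDinv-others : Char → Fin m → Carrier
  χDinv-others ψ = ∑-others (λ i → χΣinv G K ψ (Ds i))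

  sedf-character-equation : ∀ (ψ : Char) j → χΣ G K ψ (Ds j) * χDinv-others ψ j ≈ ι K lam * (∑ (χ ψ) G.elems - 1#)
  sedf-character-equation ψ j = begin
    χΣ G K ψ (Ds j) * χDinv-others ψ j
      ≈⟨ *-distribˡ-∑ _ _ (allFin m) ⟩
    ∑ (λ i → χΣ G K ψ (Ds j) * zeroIf (j? i) (χΣinv G K ψ (Ds i))) (allFin m)
      ≈⟨ ∑-cong (λ i → trans (*-zeroIf (j? i) _ _) (zeroIf-cong (j? i) (pairs i))) (allFin m) ⟩
    ∑ (λ i → zeroIf (j? i) (∑ (λ g → ι K (pairCount j i g) * χ ψ g) G.elems)) (allFin m)
      ≈⟨ ∑-cong (λ i → zeroIf-∑ (j? i) _ G.elems) (allFin m) ⟩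
    ∑ (λ i → ∑ (λ g → zeroIf (j? i) (ι K (pairCount j i g) * χ ψ g)) G.elems) (allFin m)
      ≈⟨ ∑-comm _ (allFin m) G.elems ⟩
    ∑ (λ g → ∑ (λ i → zeroIf (j? i) (ι K (pairCount j i g) * χ ψ g)) (allFin m)) G.elems
      ≈⟨ ∑-cong (λ g → trans (∑-cong (λ i → sym (zeroIf-* (j? i) _ _)) (allFin m)) (sym (*-distribʳ-∑ _ _ (allFin m)))) G.elems ⟩
    ∑ (λ g → ∑ (λ i → zeroIf (j? i) (ι K (pairCount j i g))) (allFin m) * χ ψ g) G.elems
      ≈⟨ ∑-cong (λ g → *-congʳ (sym (ι-sedfCoeff j g))) G.elems ⟩
    ∑ (λ g → ι K (sedfCoeff G m Ds j g) * χ ψ g) G.elems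
      ≈⟨ ∑-cong (λ g → trans (*-congʳ (sedfCoeff≈ j g)) (*-assoc _ _ _)) G.elems ⟩
    ∑ (λ g → ι K lam * ((1# - 𝟙 (does (G.ε G.≟ g))) * χ ψ g)) G.elems
      ≈⟨ *-distribˡ-∑ _ _ G.elems ⟨
    ι K lam * ∑ (λ g → (1# - 𝟙 (does (G.ε G.≟ g))) * χ ψ g) G.elems
      ≈⟨ *-congˡ (∑-punctured ψ) ⟩
    ι K lam * (∑ (χ ψ) G.elems - 1#) ∎
    where
    j? : Fin m → Bool
    j? i = does (i FinP.≟ j)
    pairs : ∀ i → χΣ G K ψ (Ds j) * χΣinv G K ψ (Ds i) ≈ ∑ (λ g → ι K (pairCount j i g) * χ ψ g) G.elems
    pairs i = trans (χΣ-*-χΣinv ψ (Ds j) (Ds i)) (∑-regroup quot (χ ψ) (χ-cong ψ) (cartesianProduct (Ds j) (Ds i)))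

  ι-length-D : ∀ i → ι K (length (Ds i)) ≈ ι K k
  ι-length-D i = reflexive (≡.cong (ι K) (proj₂ (ksubsets i)))

  χD-principal : ∀ (ψ : Char) → Principal G K ψ → χD G K m Ds ψ ≈ ι K m * ι K k
  χD-principal ψ pr = trans (∑-cong (λ i → trans (χΣ-principal ψ pr (Ds i)) (ι-length-D i)) (allFin m))
                            (trans (∑-const _ (allFin m)) (*-congʳ (reflexive (≡.cong (ι K) (length-allFin m)))))

  χDinv-principal : ∀ (ψ : Char) → Principal G K ψ → χDinv G K m Ds ψ ≈ ι K m * ι K k
  χDinv-principal ψ pr = trans (∑-cong (λ i → trans (χΣinv-principal ψ pr (Ds i)) (ι-length-D i)) (allFin m))
                               (trans (∑-const _ (allFin m)) (*-congʳ (reflexive (≡.cong (ι K) (length-allFin m)))))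

  principal-relation : k ℕ.* (m ℕ.* k) ℕ.+ lam ≡ k ℕ.* k ℕ.+ lam ℕ.* G.order
  principal-relation = ι-injective _ _ (begin
    ι K (k ℕ.* (m ℕ.* k) ℕ.+ lam)            ≈⟨ trans (ι-+ (k ℕ.* (m ℕ.* k)) lam) (+-congʳ (trans (ι-* k (m ℕ.* k)) (*-congˡ (ι-* m k)))) ⟩
    ι K k * (ι K m * ι K k) + ι K lam        ≈⟨ +-congʳ (*-congˡ (χDinv-principal trivial (λ _ → refl))) ⟨
    ι K k * χDinv G K m Ds trivial + ι K lam ≈⟨ +-congʳ (*-congˡ (∑-split j _)) ⟩
    ι K k * (χΣinv G K trivial (Ds j) + χDinv-others trivial j) + ι K lam
      ≈⟨ +-congʳ (*-congˡ (+-congʳ (trans (χΣinv-principal trivial (λ _ → refl) (Ds j)) (ι-length-D j)))) ⟩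
    ι K k * (ι K k + χDinv-others trivial j) + ι K lam
      ≈⟨ +-congʳ (distribˡ _ _ _) ⟩
    ι K k * ι K k + ι K k * χDinv-others trivial j + ι K lam
      ≈⟨ +-congʳ (+-congˡ (trans (*-congʳ k≈χΣDⱼ) (sedf-character-equation trivial j))) ⟩
    ι K k * ι K k + ι K lam * (∑ (χ trivial) G.elems - 1#) + ι K lam
      ≈⟨ +-congʳ (+-congˡ (*-congˡ (+-congʳ (χΣ-principal trivial (λ _ → refl) G.elems)))) ⟩
    ι K k * ι K k + ι K lam * (ι K G.order - 1#) + ι K lam
      ≈⟨ +-congˡ (*-identityʳ _) ⟨
    ι K k * ι K k + ι K lam * (ι K G.order - 1#) + ι K lam * 1#
      ≈⟨ solve 4 (λ x y z u → x :+ y :* (z :- u) :+ y :* u := x :+ y :* z) refl (ι K k * ι K k) (ι K lam) (ι K G.order) 1# ⟩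
    ι K k * ι K k + ι K lam * ι K G.order    ≈⟨ +-cong (ι-* k k) (ι-* lam G.order) ⟨
    ι K (k ℕ.* k) + ι K (lam ℕ.* G.order)    ≈⟨ ι-+ (k ℕ.* k) _ ⟨
    ι K (k ℕ.* k ℕ.+ lam ℕ.* G.order)        ∎)
    where
    j : Fin m
    j = Fin.fromℕ< (ℕP.<-≤-trans (s≤s z≤n) m≥2)
    k≈χΣDⱼ : ι K k ≈ χΣ G K trivial (Ds j)
    k≈χΣDⱼ = sym (trans (χΣ-principal trivial (λ _ → refl) (Ds j)) (ι-length-D j))

  nonprincipal-equation : ∀ (ψ : Char) → ¬ Principal G K ψ → ∀ j → χΣ G K ψ (Ds j) * χDinv-others ψ j ≈ - ι K lam
  nonprincipal-equation ψ ¬pr j = begin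
    χΣ G K ψ (Ds j) * χDinv-others ψ j   ≈⟨ sedf-character-equation ψ j ⟩
    ι K lam * (∑ (χ ψ) G.elems - 1#)     ≈⟨ *-congˡ (trans (+-congʳ (∑-nonprincipal ψ ¬pr)) (+-identityˡ _)) ⟩
    ι K lam * - 1#                       ≈⟨ -‿distribʳ-* _ _ ⟨
    - (ι K lam * 1#)                     ≈⟨ -‿cong (*-identityʳ _) ⟩
    - ι K lam                            ∎

  χΣ-χDinv : ∀ (ψ : Char) → ¬ Principal G K ψ → ∀ j →
             χΣ G K ψ (Ds j) * χDinv G K m Ds ψ ≈ χΣ G K ψ (Ds j) * χΣinv G K ψ (Ds j) - ι K lam
  χΣ-χDinv ψ ¬pr j = trans (*-congˡ (∑-split j _))
    (trans (distribˡ _ _ _) (+-congˡ (nonprincipal-equation ψ ¬pr j)))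

  χΣinv-χD : ∀ (ψ : Char) → ¬ Principal G K ψ → ∀ j →
             χΣinv G K ψ (Ds j) * χD G K m Ds ψ ≈ χΣ G K ψ (Ds j) * χΣinv G K ψ (Ds j) - ι K lam
  χΣinv-χD ψ ¬pr j = begin
    χΣinv G K ψ (Ds j) * χD G K m Ds ψ                                ≈⟨ *-congˡ (∑-split j _) ⟩
    χΣinv G K ψ (Ds j) * (χΣ G K ψ (Ds j) + χD-others ψ j)            ≈⟨ distribˡ _ _ _ ⟩
    χΣinv G K ψ (Ds j) * χΣ G K ψ (Ds j) + χΣinv G K ψ (Ds j) * χD-others ψ j
      ≈⟨ +-cong (*-comm _ _) (*-congˡ (∑-cong (λ i → zeroIf-cong (does (i FinP.≟ j)) (conj-conj (Ds i))) (allFin m))) ⟨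
    χΣ G K ψ (Ds j) * χΣinv G K ψ (Ds j) + χΣ G K (conj ψ) (Ds j) * χDinv-others (conj ψ) j
      ≈⟨ +-congˡ (nonprincipal-equation (conj ψ) (¬pr ∘ conj-principal ψ) j) ⟩
    χΣ G K ψ (Ds j) * χΣinv G K ψ (Ds j) - ι K lam ∎
    where
    conj-conj : ∀ xs → χΣinv G K (conj ψ) xs ≈ χΣ G K ψ xs
    conj-conj = ∑-cong (λ x → χ-cong ψ (GP.⁻¹-involutive x))

  diagonal-count : ∀ j → cnt (λ p → does (quot p G.≟ G.ε)) (cartesianProduct (Ds j) (Ds j)) ≡ k
  diagonal-count j = ≡.trans (go (Ds j) (λ x∈ → x∈)) (proj₂ (ksubsets j))
    where
    once : ∀ {x} → x ∈ Ds j → cnt (λ y → does (x G.≟ y)) (Ds j) ≡ 1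
    once {x} x∈ = ℕP.≤-antisym
      (≡.subst (ℕ._≤ 1) (cnt-cong (λ y → does-cong G.sym G.sym (y G.≟ x) (x G.≟ y)) (Ds j)) (proj₁ (ksubsets j) x))
      (∈⇒1≤cnt _ (Ds j) x∈ (dec-true (x G.≟ x) G.refl))
    go : ∀ xs → (∀ {x} → x ∈ xs → x ∈ Ds j) → cnt (λ p → does (quot p G.≟ G.ε)) (cartesianProduct xs (Ds j)) ≡ length xs
    go []       _   = ≡.refl
    go (x ∷ xs) xs⊆ = ≡.trans (cnt-++ q (map (x ,_) (Ds j)) _) (≡.cong₂ ℕ._+_ row (go xs (xs⊆ ∘ there)))
      where
      q : G.Carrier × G.Carrier → Bool
      q p = does (quot p G.≟ G.ε)
      quot≈ε : ∀ y → q (x , y) ≡ does (x G.≟ y)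
      quot≈ε y = does-cong (GP.x∙y⁻¹≈ε⇒x≈y x y) GP.x≈y⇒x∙y⁻¹≈ε ((x G.∙ y G.⁻¹) G.≟ G.ε) (x G.≟ y)
      row : cnt q (map (x ,_) (Ds j)) ≡ 1
      row = ≡.trans (cnt-map q (x ,_) (Ds j)) (≡.trans (cnt-cong quot≈ε (Ds j)) (once (xs⊆ (here ≡.refl))))

  ∑Ĝ-χΣ-χDinv : ∀ j → ∑Ĝ (λ i → χΣ G K (chars i) (Ds j) * χDinv G K m Ds (chars i)) ≈ ι K n * ι K k
  ∑Ĝ-χΣ-χDinv j = begin
    ∑Ĝ (λ i → χΣ G K (chars i) (Ds j) * χDinv G K m Ds (chars i))
      ≈⟨ ∑-cong (λ i → *-distribˡ-∑ _ _ (allFin m)) (allFin n) ⟩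
    ∑Ĝ (λ i → ∑ (λ l → χΣ G K (chars i) (Ds j) * χΣinv G K (chars i) (Ds l)) (allFin m))
      ≈⟨ ∑-comm _ (allFin n) (allFin m) ⟩
    ∑ (λ l → ∑Ĝ (λ i → χΣ G K (chars i) (Ds j) * χΣinv G K (chars i) (Ds l))) (allFin m)
      ≈⟨ ∑-cong (λ l → trans (∑-cong (λ i → sym (trans (*-congˡ (χ-ε⁻¹ (chars i))) (*-identityʳ _))) (allFin n))
                              (fourier-count (Ds j) (Ds l) G.ε)) (allFin m) ⟩
    ∑ (λ l → ι K n * ι K (pairCount j l G.ε)) (allFin m)
      ≈⟨ *-distribˡ-∑ _ _ (allFin m) ⟨
    ι K n * ∑ (λ l → ι K (pairCount j l G.ε)) (allFin m)
      ≈⟨ *-congˡ (∑-split j _) ⟩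
    ι K n * (ι K (pairCount j j G.ε) + ∑-others (λ l → ι K (pairCount j l G.ε)) j)
      ≈⟨ *-congˡ (+-cong (reflexive (≡.cong (ι K) (diagonal-count j))) off-diagonal) ⟩
    ι K n * (ι K k + 0#)
      ≈⟨ *-congˡ (+-identityʳ _) ⟩
    ι K n * ι K k ∎
    where
    off-diagonal : ∑-others (λ l → ι K (pairCount j l G.ε)) j ≈ 0#
    off-diagonal = trans (sym (ι-sedfCoeff j G.ε)) (reflexive (≡.cong (ι K) (coeff-1 j)))

  ∑Ĝ-χD-χDinv : ∑Ĝ (λ i → χD G K m Ds (chars i) * χDinv G K m Ds (chars i)) ≈ ι K m * (ι K n * ι K k)
  ∑Ĝ-χD-χDinv = begin
    ∑Ĝ (λ i → χD G K m Ds (chars i) * χDinv G K m Ds (chars i))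
      ≈⟨ ∑-cong (λ i → *-distribʳ-∑ _ _ (allFin m)) (allFin n) ⟩
    ∑Ĝ (λ i → ∑ (λ j → χΣ G K (chars i) (Ds j) * χDinv G K m Ds (chars i)) (allFin m))
      ≈⟨ ∑-comm _ (allFin n) (allFin m) ⟩
    ∑ (λ j → ∑Ĝ (λ i → χΣ G K (chars i) (Ds j) * χDinv G K m Ds (chars i))) (allFin m)
      ≈⟨ ∑-cong ∑Ĝ-χΣ-χDinv (allFin m) ⟩
    ∑ (λ _ → ι K n * ι K k) (allFin m)
      ≈⟨ trans (∑-const _ (allFin m)) (*-congʳ (reflexive (≡.cong (ι K) (length-allFin m)))) ⟩
    ι K m * (ι K n * ι K k) ∎

module SimpleCharacterValues {c ℓ c' ℓ'} (G : FiniteAbelianGroup c ℓ) (K : CommutativeRing c' ℓ') (dom : IsChar0DecDomain K)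
    (n : ℕ) (chars : Fin n → Character G K) (cg : IsCharacterGroup G K n chars)
    (n≡v : n ≡ FiniteAbelianGroup.order G)
    (m k lam : ℕ) (Ds : Fin m → List (FiniteAbelianGroup.Carrier G)) (sedf : IsSEDF G m k lam Ds)
    (m>2 : 2 ℕ.< m) (a b : ℕ) (scvp : SimpleCharValueProp G K m lam Ds a b) where
  open SEDFCharacters G K dom n chars cg n≡v m k lam Ds sedf public
  open Counts G K dom n chars m Ds (firstIdx G K m>2) a b public
  open CommutativeRing K
  open IsChar0DecDomain dom
  open IsSEDF sedf
  open FiniteSums K
  open Char0Domain K dom
  open RingSolver K using (quadratic-vanishes; solve; _:+_; _:*_; _:=_)
  open import Relation.Binary.Reasoning.Setoid setoid
  open import Algebra.Properties.Group +-group using (x∙y⁻¹≈ε⇒x≈y)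
  import Algebra.Properties.Group G.group as GP

  i₁ : Fin m
  i₁ = firstIdx G K m>2

  a<b : a ℕ.< b
  a<b = proj₁ (proj₂ scvp)

  simple-value : ∀ (ψ : Char) → ¬ Principal G K ψ → ¬ χD G K m Ds ψ ≈ 0# →
                 ι K (b ℕ.* b ℕ.∸ a ℕ.* a) * (χD G K m Ds ψ * χDinv G K m Ds ψ) ≈ ι K (4 ℕ.* lam ℕ.* a ℕ.* a)
  simple-value = proj₂ (proj₂ (proj₂ scvp))

  b≡a+d : b ≡ a ℕ.+ (b ℕ.∸ a)
  b≡a+d = ≡.sym (ℕP.m+[n∸m]≡n (ℕP.<⇒≤ a<b))

  a+b≈[b-a]+2a : ι K (a ℕ.+ b) ≈ ι K (b ℕ.∸ a) + ι K (2 ℕ.* a)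
  a+b≈[b-a]+2a = trans (reflexive (≡.cong (ι K) (lemma a (b ℕ.∸ a) b≡a+d))) (ι-+ (b ℕ.∸ a) (2 ℕ.* a))
    where
    lemma : ∀ a d {b} → b ≡ a ℕ.+ d → a ℕ.+ b ≡ d ℕ.+ 2 ℕ.* a
    lemma a d ≡.refl = reorder a d
      where
      reorder : ∀ a d → a ℕ.+ (a ℕ.+ d) ≡ d ℕ.+ 2 ℕ.* a
      reorder = ℕSolver.solve-∀

  [a+b][b-a]≈B : ι K (a ℕ.+ b) * ι K (b ℕ.∸ a) ≈ ι K (b ℕ.* b ℕ.∸ a ℕ.* a)
  [a+b][b-a]≈B = trans (sym (ι-* (a ℕ.+ b) (b ℕ.∸ a))) (reflexive (≡.cong (ι K) (lemma a (b ℕ.∸ a) b≡a+d)))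
    where
    lemma : ∀ a d {b} → b ≡ a ℕ.+ d → (a ℕ.+ b) ℕ.* d ≡ b ℕ.* b ℕ.∸ a ℕ.* a
    lemma a d ≡.refl = ≡.sym (≡.trans (≡.cong (ℕ._∸ a ℕ.* a) (square a d)) (ℕP.m+n∸m≡n (a ℕ.* a) _))
      where
      square : ∀ a d → (a ℕ.+ d) ℕ.* (a ℕ.+ d) ≡ a ℕ.* a ℕ.+ (a ℕ.+ (a ℕ.+ d)) ℕ.* d
      square = ℕSolver.solve-∀

  4λa²≈[2a]²λ : ι K (4 ℕ.* lam ℕ.* a ℕ.* a) ≈ ι K (2 ℕ.* a) * ι K (2 ℕ.* a) * ι K lam
  4λa²≈[2a]²λ = trans (reflexive (≡.cong (ι K) (reorder lam a)))
                      (trans (ι-* (2 ℕ.* a ℕ.* (2 ℕ.* a)) lam) (*-congʳ (ι-* (2 ℕ.* a) (2 ℕ.* a))))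
    where
    reorder : ∀ lam a → 4 ℕ.* lam ℕ.* a ℕ.* a ≡ 2 ℕ.* a ℕ.* (2 ℕ.* a) ℕ.* lam
    reorder = ℕSolver.solve-∀

  Plus : Char → Set ℓ'
  Plus ψ = ι K (2 ℕ.* a) * χΣ G K ψ (Ds i₁) ≈ ι K (a ℕ.+ b) * χD G K m Ds ψ

  Minus : Char → Set ℓ'
  Minus ψ = ι K (2 ℕ.* a) * χΣ G K ψ (Ds i₁) + ι K (b ℕ.∸ a) * χD G K m Ds ψ ≈ 0#

  λ≉0 : ¬ ι K lam ≈ 0#
  λ≉0 = ι≉0 lam≥1

  factors-vanish : ∀ (ψ : Char) → ¬ Principal G K ψ → ¬ χD G K m Ds ψ ≈ 0# →
    ι K lam * ((ι K (2 ℕ.* a) * χΣ G K ψ (Ds i₁) - ι K (a ℕ.+ b) * χD G K m Ds ψ) *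
               (ι K (2 ℕ.* a) * χΣ G K ψ (Ds i₁) + ι K (b ℕ.∸ a) * χD G K m Ds ψ)) ≈ 0#
  factors-vanish ψ ¬pr X≉0 = quadratic-vanishes (χΣ G K ψ (Ds i₁)) (χD G K m Ds ψ) (χDinv G K m Ds ψ) (χΣinv G K ψ (Ds i₁))
      (ι K lam) (ι K (2 ℕ.* a)) (ι K (a ℕ.+ b)) (ι K (b ℕ.∸ a)) (ι K (b ℕ.* b ℕ.∸ a ℕ.* a)) (ι K (4 ℕ.* lam ℕ.* a ℕ.* a))
      (χΣ-χDinv ψ ¬pr i₁) (χΣinv-χD ψ ¬pr i₁) (simple-value ψ ¬pr X≉0)
      a+b≈[b-a]+2a [a+b][b-a]≈B 4λa²≈[2a]²λ

  plus-or-minus : ∀ (ψ : Char) → ¬ Principal G K ψ → ¬ χD G K m Ds ψ ≈ 0# → Plus ψ ⊎ Minus ψ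
  plus-or-minus ψ ¬pr X≉0 =
    [ (λ λ≈0 → contradiction λ≈0 λ≉0)
    , (λ factors≈0 → Sum.map₁ (x∙y⁻¹≈ε⇒x≈y _ _) (no-zero-divisors _ _ factors≈0))
    ]′ (no-zero-divisors (ι K lam) _ (factors-vanish ψ ¬pr X≉0))

  not-plus-and-minus : ∀ (ψ : Char) → ¬ χD G K m Ds ψ ≈ 0# → Plus ψ → Minus ψ → ⊥
  not-plus-and-minus ψ X≉0 plus minus = X≉0 (sym (*-cancelˡ (ι K (a ℕ.+ b) + ι K (b ℕ.∸ a)) 0# X sum≉0 (begin
    (ι K (a ℕ.+ b) + ι K (b ℕ.∸ a)) * 0#                           ≈⟨ zeroʳ _ ⟩
    0#                                                            ≈⟨ minus ⟨
    ι K (2 ℕ.* a) * χΣ G K ψ (Ds i₁) + ι K (b ℕ.∸ a) * X            ≈⟨ +-congʳ plus ⟩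
    ι K (a ℕ.+ b) * X + ι K (b ℕ.∸ a) * X                          ≈⟨ distribʳ _ _ _ ⟨
    (ι K (a ℕ.+ b) + ι K (b ℕ.∸ a)) * X                            ∎)))
    where
    X : Carrier
    X = χD G K m Ds ψ
    sum≉0 : ¬ ι K (a ℕ.+ b) + ι K (b ℕ.∸ a) ≈ 0#
    sum≉0 = ι≉0 (ℕP.<-≤-trans (ℕP.≤-<-trans z≤n a<b) (ℕP.≤-trans (ℕP.m≤n+m b a) (ℕP.m≤m+n _ _))) ∘ trans (ι-+ (a ℕ.+ b) (b ℕ.∸ a))

  nonPrincipalB≡ : ∀ (ψ : Char) → nonPrincipalB ψ ≡ does (nonPrincipal? ψ)
  nonPrincipalB≡ ψ = foldr-∨-does _ G.elems

  nonPrincipal-reflects : ∀ (ψ : Char) → Reflects (¬ Principal G K ψ) (nonPrincipalB ψ)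
  nonPrincipal-reflects ψ = ≡.subst (Reflects _) (≡.sym (nonPrincipalB≡ ψ)) (proof (nonPrincipal? ψ))

  ¬nonPrincipal⇒principal : ∀ (ψ : Char) → ¬ ¬ Principal G K ψ → Principal G K ψ
  ¬nonPrincipal⇒principal ψ ¬¬pr g = decidable-stable (χ ψ g ≈? 1#) (λ χg≉1 → ¬¬pr (λ pr → χg≉1 (pr g)))

  B : ℕ
  B = b ℕ.* b ℕ.∸ a ℕ.* a

  fourλa² : ℕ
  fourλa² = 4 ℕ.* lam ℕ.* a ℕ.* a

  -- np, z, p, q stand for the tests of Counts: χ nonprincipal, χ(D) = 0, the Ĝ⁺ and the Ĝ⁻ equation.
  record Summands (ψ : Char) (np z p q : Bool) : Set ℓ' where
    field
      partition   : 1# ≈ 𝟙 (not np) + 𝟙 (np ∧ z) + 𝟙 ((np ∧ not z) ∧ p) + 𝟙 ((np ∧ not z) ∧ q)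
      parseval    : ι K B * (χD G K m Ds ψ * χDinv G K m Ds ψ)
                      ≈ 𝟙 (not np) * (ι K B * ((ι K m * ι K k) * (ι K m * ι K k)))
                        + (𝟙 ((np ∧ not z) ∧ p) + 𝟙 ((np ∧ not z) ∧ q)) * ι K fourλa²
      correlation : ι K (2 ℕ.* a) * (ι K B * (χΣ G K ψ (Ds i₁) * χDinv G K m Ds ψ))
                      + 𝟙 ((np ∧ not z) ∧ q) * (ι K (b ℕ.∸ a) * ι K fourλa²)
                      ≈ 𝟙 (not np) * (ι K (2 ℕ.* a) * (ι K B * (ι K k * (ι K m * ι K k))))
                        + 𝟙 ((np ∧ not z) ∧ p) * (ι K (a ℕ.+ b) * ι K fourλa²)

  principal-summands : ∀ (ψ : Char) {z p q} → Principal G K ψ → Summands ψ false z p q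
  principal-summands ψ pr = record
    { partition   = sym (trans (+-identityʳ _) (trans (+-identityʳ _) (+-identityʳ _)))
    ; parseval    = trans (*-congˡ (*-cong (χD-principal ψ pr) (χDinv-principal ψ pr)))
                          (sym (trans (+-cong (*-identityˡ _) (trans (*-congʳ (+-identityʳ 0#)) (zeroˡ _))) (+-identityʳ _)))
    ; correlation = trans (+-congˡ (zeroˡ _)) (trans (+-congʳ (*-congˡ (*-congˡ (*-cong t≈k (χDinv-principal ψ pr)))))
                          (sym (+-cong (*-identityˡ _) (zeroˡ _))))
    }
    where
    t≈k : χΣ G K ψ (Ds i₁) ≈ ι K k
    t≈k = trans (χΣ-principal ψ pr (Ds i₁)) (ι-length-D i₁)

  vanishing-summands : ∀ (ψ : Char) {p q} → ¬ Principal G K ψ → χD G K m Ds ψ ≈ 0# → Summands ψ true true p q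
  vanishing-summands ψ ¬pr X≈0 = record
    { partition   = sym (trans (+-identityʳ _) (trans (+-identityʳ _) (+-identityˡ _)))
    ; parseval    = trans (trans (*-congˡ (trans (*-congʳ X≈0) (zeroˡ _))) (zeroʳ _))
                          (sym (trans (+-cong (zeroˡ _) (trans (*-congʳ (+-identityʳ 0#)) (zeroˡ _))) (+-identityʳ 0#)))
    ; correlation = trans (trans (+-cong (trans (*-congˡ (trans (*-congˡ tY≈0) (zeroʳ _))) (zeroʳ _)) (zeroˡ _)) (+-identityʳ 0#))
                          (sym (trans (+-cong (zeroˡ _) (zeroˡ _)) (+-identityʳ 0#)))
    }
    where
    tY≈0 : χΣ G K ψ (Ds i₁) * χDinv G K m Ds ψ ≈ 0#
    tY≈0 = trans (trans (χΣ-χDinv ψ ¬pr i₁) (sym (χΣinv-χD ψ ¬pr i₁))) (trans (*-congˡ X≈0) (zeroʳ _))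

  plus-summands : ∀ (ψ : Char) → ¬ Principal G K ψ → ¬ χD G K m Ds ψ ≈ 0# → Plus ψ → Summands ψ true false true false
  plus-summands ψ ¬pr X≉0 plus = record
    { partition   = sym (trans (+-identityʳ _) (trans (+-congʳ (+-identityʳ 0#)) (+-identityˡ 1#)))
    ; parseval    = trans (simple-value ψ ¬pr X≉0)
                          (sym (trans (+-cong (zeroˡ _) (trans (*-congʳ (+-identityʳ 1#)) (*-identityˡ _))) (+-identityˡ _)))
    ; correlation = begin
        ι K (2 ℕ.* a) * (ι K B * (t * Y)) + 0# * (ι K (b ℕ.∸ a) * ι K fourλa²) ≈⟨ trans (+-congˡ (zeroˡ _)) (+-identityʳ _) ⟩
        ι K (2 ℕ.* a) * (ι K B * (t * Y))      ≈⟨ solve 4 (λ c B t Y → c :* (B :* (t :* Y)) := B :* Y :* (c :* t)) refl _ _ t Y ⟩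
        ι K B * Y * (ι K (2 ℕ.* a) * t)        ≈⟨ *-congˡ plus ⟩
        ι K B * Y * (ι K (a ℕ.+ b) * X)        ≈⟨ solve 4 (λ B Y p X → B :* Y :* (p :* X) := p :* (B :* (X :* Y))) refl _ Y _ X ⟩
        ι K (a ℕ.+ b) * (ι K B * (X * Y))      ≈⟨ *-congˡ (simple-value ψ ¬pr X≉0) ⟩
        ι K (a ℕ.+ b) * ι K fourλa²            ≈⟨ trans (+-cong (zeroˡ _) (*-identityˡ _)) (+-identityˡ _) ⟨
        0# * (ι K (2 ℕ.* a) * (ι K B * (ι K k * (ι K m * ι K k)))) + 1# * (ι K (a ℕ.+ b) * ι K fourλa²) ∎
    }
    where
    t X Y : Carrier
    t = χΣ G K ψ (Ds i₁)
    X = χD G K m Ds ψ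
    Y = χDinv G K m Ds ψ

  minus-summands : ∀ (ψ : Char) → ¬ Principal G K ψ → ¬ χD G K m Ds ψ ≈ 0# → Minus ψ → Summands ψ true false false true
  minus-summands ψ ¬pr X≉0 minus = record
    { partition   = sym (trans (+-congʳ (trans (+-identityʳ _) (+-identityʳ 0#))) (+-identityˡ 1#))
    ; parseval    = trans (simple-value ψ ¬pr X≉0)
                          (sym (trans (+-cong (zeroˡ _) (trans (*-congʳ (+-identityˡ 1#)) (*-identityˡ _))) (+-identityˡ _)))
    ; correlation = begin
        ι K (2 ℕ.* a) * (ι K B * (t * Y)) + 1# * (ι K (b ℕ.∸ a) * ι K fourλa²)
          ≈⟨ +-congˡ (trans (*-identityˡ _) (*-congˡ (sym (simple-value ψ ¬pr X≉0)))) ⟩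
        ι K (2 ℕ.* a) * (ι K B * (t * Y)) + ι K (b ℕ.∸ a) * (ι K B * (X * Y))
          ≈⟨ solve 6 (λ c B t Y q X → c :* (B :* (t :* Y)) :+ q :* (B :* (X :* Y)) := B :* Y :* (c :* t :+ q :* X))
                     refl _ _ t Y _ X ⟩
        ι K B * Y * (ι K (2 ℕ.* a) * t + ι K (b ℕ.∸ a) * X)
          ≈⟨ trans (*-congˡ minus) (zeroʳ _) ⟩
        0#
          ≈⟨ trans (+-cong (zeroˡ _) (zeroˡ _)) (+-identityʳ 0#) ⟨
        0# * (ι K (2 ℕ.* a) * (ι K B * (ι K k * (ι K m * ι K k)))) + 0# * (ι K (a ℕ.+ b) * ι K fourλa²) ∎
    }
    where
    t X Y : Carrier
    t = χΣ G K ψ (Ds i₁)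
    X = χD G K m Ds ψ
    Y = χDinv G K m Ds ψ

  summands-reflecting : ∀ (ψ : Char) {np z p q} → Reflects (¬ Principal G K ψ) np → Reflects (χD G K m Ds ψ ≈ 0#) z →
                        Reflects (Plus ψ) p → Reflects (Minus ψ) q → Summands ψ np z p q
  summands-reflecting ψ (ofⁿ ¬¬pr) _ _ _ = principal-summands ψ (¬nonPrincipal⇒principal ψ ¬¬pr)
  summands-reflecting ψ (ofʸ ¬pr) (ofʸ X≈0) _ _ = vanishing-summands ψ ¬pr X≈0
  summands-reflecting ψ (ofʸ ¬pr) (ofⁿ X≉0) (ofʸ plus)  (ofʸ minus)  = ⊥-elim (not-plus-and-minus ψ X≉0 plus minus)
  summands-reflecting ψ (ofʸ ¬pr) (ofⁿ X≉0) (ofʸ plus)  (ofⁿ _)      = plus-summands ψ ¬pr X≉0 plus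
  summands-reflecting ψ (ofʸ ¬pr) (ofⁿ X≉0) (ofⁿ _)     (ofʸ minus)  = minus-summands ψ ¬pr X≉0 minus
  summands-reflecting ψ (ofʸ ¬pr) (ofⁿ X≉0) (ofⁿ ¬plus) (ofⁿ ¬minus) =
    ⊥-elim ([ ¬plus , ¬minus ]′ (plus-or-minus ψ ¬pr X≉0))

  summands : ∀ (ψ : Char) → Summands ψ (nonPrincipalB ψ) (does (χD G K m Ds ψ ≈? 0#))
                              (does ((ι K (2 ℕ.* a) * χΣ G K ψ (Ds i₁)) ≈? (ι K (a ℕ.+ b) * χD G K m Ds ψ)))
                              (does ((ι K (2 ℕ.* a) * χΣ G K ψ (Ds i₁) + ι K (b ℕ.∸ a) * χD G K m Ds ψ) ≈? 0#))
  summands ψ = summands-reflecting ψ (nonPrincipal-reflects ψ) (proof (χD G K m Ds ψ ≈? 0#)) (proof (_ ≈? _)) (proof (_ ≈? _))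

  #P : ℕ
  #P = countChars (not ∘ nonPrincipalB)

  #P≡1 : #P ≡ 1
  #P≡1 = cnt-allFin-unique _ trivialIndex
    (≡.cong not (≡.trans (nonPrincipalB≡ (chars trivialIndex)) (dec-false (nonPrincipal? (chars trivialIndex)) (λ ¬pr → ¬pr principal-trivialIndex))))
    (λ i pi → principal⇒trivialIndex i (¬nonPrincipal⇒principal (chars i)
                (refutation (nonPrincipal? (chars i)) (≡.trans (≡.sym (nonPrincipalB≡ (chars i))) (not≡true pi)))))

  partition-sum : ι K n ≈ ι K #P + ι K #G0 + ι K #G+ + ι K #G-
  partition-sum = begin
    ι K n                                  ≈⟨ trans (*-identityʳ _) (reflexive (≡.cong (ι K) (length-allFin n))) ⟨
    ι K (length (allFin n)) * 1#           ≈⟨ ∑-const 1# (allFin n) ⟨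
    ∑Ĝ (λ _ → 1#)                          ≈⟨ ∑-cong (λ i → Summands.partition (summands (chars i))) (allFin n) ⟩
    ∑Ĝ (λ i → 𝟙 (not (nonPrincipalB (chars i))) + 𝟙 (in0B (chars i)) + 𝟙 (inPlusB (chars i)) + 𝟙 (inMinusB (chars i)))
      ≈⟨ trans (∑-+ _ _ (allFin n)) (+-congʳ (trans (∑-+ _ _ (allFin n)) (+-congʳ (∑-+ _ _ (allFin n))))) ⟩
    ∑Ĝ (𝟙 ∘ not ∘ nonPrincipalB ∘ chars) + ∑Ĝ (𝟙 ∘ in0B ∘ chars) + ∑Ĝ (𝟙 ∘ inPlusB ∘ chars) + ∑Ĝ (𝟙 ∘ inMinusB ∘ chars)
      ≈⟨ +-cong (+-cong (+-cong (ι-cnt _ (allFin n)) (ι-cnt _ (allFin n))) (ι-cnt _ (allFin n))) (ι-cnt _ (allFin n)) ⟨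
    ι K #P + ι K #G0 + ι K #G+ + ι K #G- ∎

  parseval-sum : ι K B * (ι K m * (ι K n * ι K k))
                   ≈ ι K #P * (ι K B * ((ι K m * ι K k) * (ι K m * ι K k))) + (ι K #G+ + ι K #G-) * ι K fourλa²
  parseval-sum = begin
    ι K B * (ι K m * (ι K n * ι K k))
      ≈⟨ *-congˡ ∑Ĝ-χD-χDinv ⟨
    ι K B * ∑Ĝ (λ i → χD G K m Ds (chars i) * χDinv G K m Ds (chars i))
      ≈⟨ *-distribˡ-∑ _ _ (allFin n) ⟩
    ∑Ĝ (λ i → ι K B * (χD G K m Ds (chars i) * χDinv G K m Ds (chars i)))
      ≈⟨ ∑-cong (λ i → trans (Summands.parseval (summands (chars i))) (+-congˡ (distribʳ _ _ _))) (allFin n) ⟩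
    ∑Ĝ (λ i → 𝟙 (not (nonPrincipalB (chars i))) * c₁ + (𝟙 (inPlusB (chars i)) * ι K fourλa² + 𝟙 (inMinusB (chars i)) * ι K fourλa²))
      ≈⟨ trans (∑-+ _ _ (allFin n)) (+-congˡ (∑-+ _ _ (allFin n))) ⟩
    ∑Ĝ (λ i → 𝟙 (not (nonPrincipalB (chars i))) * c₁)
      + (∑Ĝ (λ i → 𝟙 (inPlusB (chars i)) * ι K fourλa²) + ∑Ĝ (λ i → 𝟙 (inMinusB (chars i)) * ι K fourλa²))
      ≈⟨ +-cong (∑-indicator _ c₁ (allFin n)) (+-cong (∑-indicator _ _ (allFin n)) (∑-indicator _ _ (allFin n))) ⟩
    ι K #P * c₁ + (ι K #G+ * ι K fourλa² + ι K #G- * ι K fourλa²)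
      ≈⟨ +-congˡ (distribʳ _ _ _) ⟨
    ι K #P * c₁ + (ι K #G+ + ι K #G-) * ι K fourλa² ∎
    where
    c₁ : Carrier
    c₁ = ι K B * ((ι K m * ι K k) * (ι K m * ι K k))

  correlation-sum : ι K (2 ℕ.* a) * (ι K B * (ι K n * ι K k)) + ι K #G- * (ι K (b ℕ.∸ a) * ι K fourλa²)
                      ≈ ι K #P * (ι K (2 ℕ.* a) * (ι K B * (ι K k * (ι K m * ι K k)))) + ι K #G+ * (ι K (a ℕ.+ b) * ι K fourλa²)
  correlation-sum = begin
    ι K (2 ℕ.* a) * (ι K B * (ι K n * ι K k)) + ι K #G- * (ι K (b ℕ.∸ a) * ι K fourλa²)
      ≈⟨ +-cong (*-congˡ (*-congˡ (∑Ĝ-χΣ-χDinv i₁))) (∑-indicator _ _ (allFin n)) ⟨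
    ι K (2 ℕ.* a) * (ι K B * ∑Ĝ (λ i → χΣ G K (chars i) (Ds i₁) * χDinv G K m Ds (chars i)))
      + ∑Ĝ (λ i → 𝟙 (inMinusB (chars i)) * (ι K (b ℕ.∸ a) * ι K fourλa²))
      ≈⟨ +-congʳ (trans (*-congˡ (*-distribˡ-∑ _ _ (allFin n))) (*-distribˡ-∑ _ _ (allFin n))) ⟩
    ∑Ĝ (λ i → ι K (2 ℕ.* a) * (ι K B * (χΣ G K (chars i) (Ds i₁) * χDinv G K m Ds (chars i))))
      + ∑Ĝ (λ i → 𝟙 (inMinusB (chars i)) * (ι K (b ℕ.∸ a) * ι K fourλa²))
      ≈⟨ ∑-+ _ _ (allFin n) ⟨
    ∑Ĝ (λ i → ι K (2 ℕ.* a) * (ι K B * (χΣ G K (chars i) (Ds i₁) * χDinv G K m Ds (chars i)))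
              + 𝟙 (inMinusB (chars i)) * (ι K (b ℕ.∸ a) * ι K fourλa²))
      ≈⟨ ∑-cong (λ i → Summands.correlation (summands (chars i))) (allFin n) ⟩
    ∑Ĝ (λ i → 𝟙 (not (nonPrincipalB (chars i))) * c₂ + 𝟙 (inPlusB (chars i)) * (ι K (a ℕ.+ b) * ι K fourλa²))
      ≈⟨ ∑-+ _ _ (allFin n) ⟩
    ∑Ĝ (λ i → 𝟙 (not (nonPrincipalB (chars i))) * c₂) + ∑Ĝ (λ i → 𝟙 (inPlusB (chars i)) * (ι K (a ℕ.+ b) * ι K fourλa²))
      ≈⟨ +-cong (∑-indicator _ _ (allFin n)) (∑-indicator _ _ (allFin n)) ⟩
    ι K #P * c₂ + ι K #G+ * (ι K (a ℕ.+ b) * ι K fourλa²) ∎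
    where
    c₂ : Carrier
    c₂ = ι K (2 ℕ.* a) * (ι K B * (ι K k * (ι K m * ι K k)))

  nonvanishing⇒counted : ∀ (ψ : Char) → ¬ Principal G K ψ → ¬ χD G K m Ds ψ ≈ 0# → inPlusB ψ ≡ true ⊎ inMinusB ψ ≡ true
  nonvanishing⇒counted ψ ¬pr X≉0 =
    Sum.map (∧-not-∧ np X≢0 ∘ dec-true ((ι K (2 ℕ.* a) * χΣ G K ψ (Ds i₁)) ≈? (ι K (a ℕ.+ b) * χD G K m Ds ψ)))
            (∧-not-∧ np X≢0 ∘ dec-true ((ι K (2 ℕ.* a) * χΣ G K ψ (Ds i₁) + ι K (b ℕ.∸ a) * χD G K m Ds ψ) ≈? 0#))
            (plus-or-minus ψ ¬pr X≉0)
    where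
    np : nonPrincipalB ψ ≡ true
    np = ≡.trans (nonPrincipalB≡ ψ) (dec-true (nonPrincipal? ψ) ¬pr)
    X≢0 : does (χD G K m Ds ψ ≈? 0#) ≡ false
    X≢0 = dec-false (χD G K m Ds ψ ≈? 0#) X≉0

  module _ (uncounted : #G+ ℕ.+ #G- ≡ 0) where

    χD≈0 : ∀ i → ¬ Principal G K (chars i) → χD G K m Ds (chars i) ≈ 0#
    χD≈0 i ¬pr = decidable-stable (χD G K m Ds (chars i) ≈? 0#) λ X≉0 →
      [ (λ plus  → contradiction (≡.trans (≡.sym plus) (uncounted-in inPlusB (ℕP.m+n≡0⇒m≡0 #G+ uncounted))) λ ())
      , (λ minus → contradiction (≡.trans (≡.sym minus) (uncounted-in inMinusB (ℕP.m+n≡0⇒n≡0 #G+ uncounted))) λ ())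
      ]′ (nonvanishing⇒counted (chars i) ¬pr X≉0)
      where
      uncounted-in : ∀ p → countChars p ≡ 0 → p (chars i) ≡ false
      uncounted-in p none = cnt≡0⇒false (p ∘ chars) (allFin n) none (∈-allFin i)

    χΣ-χΣinv≈λ : ∀ i → ¬ Principal G K (chars i) → χΣ G K (chars i) (Ds i₁) * χΣinv G K (chars i) (Ds i₁) ≈ ι K lam
    χΣ-χΣinv≈λ i ¬pr = x∙y⁻¹≈ε⇒x≈y _ _ (trans (sym (χΣinv-χD (chars i) ¬pr i₁)) (trans (*-congˡ (χD≈0 i ¬pr)) (zeroʳ _)))

    χΣ-χΣinv-split : ∀ g i (i≟i₀ : Dec (i ≡ trivialIndex)) →
                     (χΣ G K (chars i) (Ds i₁) * χΣinv G K (chars i) (Ds i₁)) * χ (chars i) g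
                       ≈ 𝟙 (does i≟i₀) * (ι K k * ι K k - ι K lam) + ι K lam * χ (chars i) g
    χΣ-χΣinv-split g i (yes ≡.refl) = begin
      (χΣ G K (chars i) (Ds i₁) * χΣinv G K (chars i) (Ds i₁)) * χ (chars i) g
        ≈⟨ trans (*-cong (*-cong k₁ k₂) (principal-trivialIndex g)) (*-identityʳ _) ⟩
      ι K k * ι K k
        ≈⟨ trans (+-congˡ (-‿inverseˡ _)) (+-identityʳ _) ⟨
      ι K k * ι K k + (- ι K lam + ι K lam)
        ≈⟨ +-assoc _ _ _ ⟨
      (ι K k * ι K k - ι K lam) + ι K lam
        ≈⟨ +-cong (*-identityˡ _) (trans (*-congˡ (principal-trivialIndex g)) (*-identityʳ _)) ⟨
      1# * (ι K k * ι K k - ι K lam) + ι K lam * χ (chars i) g ∎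
      where
      k₁ : χΣ G K (chars i) (Ds i₁) ≈ ι K k
      k₁ = trans (χΣ-principal (chars i) principal-trivialIndex (Ds i₁)) (ι-length-D i₁)
      k₂ : χΣinv G K (chars i) (Ds i₁) ≈ ι K k
      k₂ = trans (χΣinv-principal (chars i) principal-trivialIndex (Ds i₁)) (ι-length-D i₁)
    χΣ-χΣinv-split g i (no i≢i₀) = trans (*-congʳ (χΣ-χΣinv≈λ i (i≢i₀ ∘ principal⇒trivialIndex i)))
                                         (sym (trans (+-congʳ (zeroˡ _)) (+-identityˡ _)))

    -- Fourier inversion: n · pairCount i₁ i₁ h = ∑_χ |χ(D₁)|² χ(h⁻¹), and |χ(D₁)|² = λ for χ ≠ 1.
    pairCount-relation : ∀ h → ¬ h G.≈ G.ε → ι K n * ι K (pairCount i₁ i₁ h) + ι K lam ≈ ι K k * ι K k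
    pairCount-relation h h≉ε = begin
      ι K n * ι K (pairCount i₁ i₁ h) + ι K lam
        ≈⟨ +-congʳ (fourier-count (Ds i₁) (Ds i₁) h) ⟨
      ∑Ĝ (λ i → (χΣ G K (chars i) (Ds i₁) * χΣinv G K (chars i) (Ds i₁)) * χ (chars i) (h G.⁻¹)) + ι K lam
        ≈⟨ +-congʳ (∑-cong (λ i → χΣ-χΣinv-split (h G.⁻¹) i (i FinP.≟ trivialIndex)) (allFin n)) ⟩
      ∑Ĝ (λ i → 𝟙 (does (i FinP.≟ trivialIndex)) * (ι K k * ι K k - ι K lam) + ι K lam * χ (chars i) (h G.⁻¹)) + ι K lam
        ≈⟨ +-congʳ (trans (∑-+ _ _ (allFin n)) (+-cong (∑-allFin-δ trivialIndex _) (sym (*-distribˡ-∑ _ _ (allFin n))))) ⟩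
      (ι K k * ι K k - ι K lam) + ι K lam * columnSum (h G.⁻¹) + ι K lam
        ≈⟨ +-congʳ (+-congˡ (trans (*-congˡ (dual-orthogonality (h G.⁻¹))) (trans (*-congˡ (*-congˡ h⁻¹≢ε)) (trans (*-congˡ (zeroʳ _)) (zeroʳ _))))) ⟩
      (ι K k * ι K k - ι K lam) + 0# + ι K lam
        ≈⟨ +-congʳ (+-identityʳ _) ⟩
      (ι K k * ι K k - ι K lam) + ι K lam
        ≈⟨ trans (+-assoc _ _ _) (trans (+-congˡ (-‿inverseˡ _)) (+-identityʳ _)) ⟩
      ι K k * ι K k ∎
      where
      h⁻¹≢ε : 𝟙 (does ((h G.⁻¹) G.≟ G.ε)) ≈ 0#
      h⁻¹≢ε = reflexive (≡.cong 𝟙 (dec-false ((h G.⁻¹) G.≟ G.ε) (λ h⁻¹≈ε → h≉ε (GP.⁻¹-injective (G.trans h⁻¹≈ε (G.sym GP.ε⁻¹≈ε))))))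
    n≡mk : n ≡ m ℕ.* k
    n≡mk = ι-injective n (m ℕ.* k) (trans (*-cancelˡ d _ _ d≉0 (begin
      d * ι K n                                   ≈⟨ solve 4 (λ B m k n → B :* (m :* k) :* n := B :* (m :* (n :* k))) refl _ _ _ _ ⟩
      ι K B * (ι K m * (ι K n * ι K k))           ≈⟨ parseval-sum ⟩
      ι K #P * c₁ + (ι K #G+ + ι K #G-) * ι K fourλa²
        ≈⟨ +-cong (*-congʳ (trans (reflexive (≡.cong (ι K) #P≡1)) ι-1)) (*-congʳ (trans (sym (ι-+ #G+ #G-)) (reflexive (≡.cong (ι K) uncounted)))) ⟩
      1# * c₁ + 0# * ι K fourλa²                  ≈⟨ trans (+-cong (*-identityˡ _) (zeroˡ _)) (+-identityʳ _) ⟩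
      c₁                                          ≈⟨ solve 3 (λ B m k → B :* ((m :* k) :* (m :* k)) := B :* (m :* k) :* (m :* k)) refl _ _ _ ⟩
      d * (ι K m * ι K k)                         ∎)) (sym (ι-* m k)))
      where
      d : Carrier
      d = ι K B * (ι K m * ι K k)
      c₁ : Carrier
      c₁ = ι K B * ((ι K m * ι K k) * (ι K m * ι K k))
      B-positive : 0 ℕ.< B
      B-positive = ℕP.m<n⇒0<n∸m (ℕP.*-mono-< a<b a<b)
      d≉0 : ¬ d ≈ 0#
      d≉0 = *-≉0 (ι≉0 B-positive) (*-≉0 (ι≉0 (ℕP.<-trans (s≤s z≤n) m>2)) (ι≉0 k≥1))

  counts-positive : 1 ℕ.< k → 0 ℕ.< #G+ ℕ.+ #G-
  counts-positive 1<k = ℕP.n≢0⇒n>0 λ uncounted →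
    square-relations-incompatible m k μ lam (ℕP.<-trans (s≤s z≤n) m>2) μ≥1 lam≥1
      (≡.subst (λ v → k ℕ.* (m ℕ.* k) ℕ.+ lam ≡ k ℕ.* k ℕ.+ lam ℕ.* v) (≡.trans (≡.sym n≡v) (n≡mk uncounted)) principal-relation)
      (≡.sym (≡.subst (λ v → v ℕ.* μ ℕ.+ lam ≡ k ℕ.* k) (n≡mk uncounted)
        (ι-injective _ _ (trans (ι-+ (n ℕ.* μ) lam) (trans (+-congʳ (ι-* n μ))
          (trans (pairCount-relation uncounted h h≉ε) (sym (ι-* k k))))))))
    where
    distinct : ∃ λ x → ∃ λ y → x ∈ Ds i₁ × y ∈ Ds i₁ × ¬ x G.≈ y
    distinct = two-distinct (Ds i₁) (proj₁ (ksubsets i₁)) (≡.subst (2 ℕ.≤_) (≡.sym (proj₂ (ksubsets i₁))) 1<k)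
    x y h : G.Carrier
    x = proj₁ distinct
    y = proj₁ (proj₂ distinct)
    h = quot (x , y)
    μ : ℕ
    μ = pairCount i₁ i₁ h
    μ≥1 : 1 ℕ.≤ μ
    μ≥1 = ∈⇒1≤cnt _ (cartesianProduct (Ds i₁) (Ds i₁))
            (∈-cartesianProduct⁺ (proj₁ (proj₂ (proj₂ distinct))) (proj₁ (proj₂ (proj₂ (proj₂ distinct)))))
            (dec-true (h G.≟ h) G.refl)
    h≉ε : ¬ h G.≈ G.ε
    h≉ε = proj₂ (proj₂ (proj₂ (proj₂ distinct))) ∘ GP.x∙y⁻¹≈ε⇒x≈y x y

  partitionℤ : + G.order ≡ + 1 ℤ.+ + #G0 ℤ.+ + #G+ ℤ.+ + #G-
  partitionℤ = ⟦⟧-injective ⌜ G.order ⌝ (⌜ 1 ⌝ ⊕ ⌜ #G0 ⌝ ⊕ ⌜ #G+ ⌝ ⊕ ⌜ #G- ⌝)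
    (≡.subst₂ (λ v p → ι K v ≈ ι K p + ι K #G0 + ι K #G+ + ι K #G-) n≡v #P≡1 partition-sum)

  parsevalℤ : + B ℤ.* (+ m ℤ.* (+ G.order ℤ.* + k))
                ≡ + 1 ℤ.* (+ B ℤ.* ((+ m ℤ.* + k) ℤ.* (+ m ℤ.* + k))) ℤ.+ (+ #G+ ℤ.+ + #G-) ℤ.* + fourλa²
  parsevalℤ = ⟦⟧-injective (⌜ B ⌝ ⊛ (⌜ m ⌝ ⊛ (⌜ G.order ⌝ ⊛ ⌜ k ⌝)))
                           (⌜ 1 ⌝ ⊛ (⌜ B ⌝ ⊛ ((⌜ m ⌝ ⊛ ⌜ k ⌝) ⊛ (⌜ m ⌝ ⊛ ⌜ k ⌝))) ⊕ (⌜ #G+ ⌝ ⊕ ⌜ #G- ⌝) ⊛ ⌜ fourλa² ⌝)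
    (≡.subst₂ (λ v p → ι K B * (ι K m * (ι K v * ι K k))
                         ≈ ι K p * (ι K B * ((ι K m * ι K k) * (ι K m * ι K k))) + (ι K #G+ + ι K #G-) * ι K fourλa²)
              n≡v #P≡1 parseval-sum)

  correlationℤ : + (2 ℕ.* a) ℤ.* (+ B ℤ.* (+ G.order ℤ.* + k)) ℤ.+ + #G- ℤ.* (+ (b ℕ.∸ a) ℤ.* + fourλa²)
                   ≡ + 1 ℤ.* (+ (2 ℕ.* a) ℤ.* (+ B ℤ.* (+ k ℤ.* (+ m ℤ.* + k)))) ℤ.+ + #G+ ℤ.* (+ (a ℕ.+ b) ℤ.* + fourλa²)
  correlationℤ = ⟦⟧-injective (⌜ 2 ℕ.* a ⌝ ⊛ (⌜ B ⌝ ⊛ (⌜ G.order ⌝ ⊛ ⌜ k ⌝)) ⊕ ⌜ #G- ⌝ ⊛ (⌜ b ℕ.∸ a ⌝ ⊛ ⌜ fourλa² ⌝))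
                              (⌜ 1 ⌝ ⊛ (⌜ 2 ℕ.* a ⌝ ⊛ (⌜ B ⌝ ⊛ (⌜ k ⌝ ⊛ (⌜ m ⌝ ⊛ ⌜ k ⌝)))) ⊕ ⌜ #G+ ⌝ ⊛ (⌜ a ℕ.+ b ⌝ ⊛ ⌜ fourλa² ⌝))
    (≡.subst₂ (λ v p → ι K (2 ℕ.* a) * (ι K B * (ι K v * ι K k)) + ι K #G- * (ι K (b ℕ.∸ a) * ι K fourλa²)
                         ≈ ι K p * (ι K (2 ℕ.* a) * (ι K B * (ι K k * (ι K m * ι K k)))) + ι K #G+ * (ι K (a ℕ.+ b) * ι K fourλa²))
              n≡v #P≡1 correlation-sum)

  principalℤ : + k ℤ.* (+ m ℤ.* + k) ℤ.+ + lam ≡ + k ℤ.* + k ℤ.+ + lam ℤ.* + G.order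
  principalℤ = ⟦⟧ℕ⇒⟦⟧ℤ (⌜ k ⌝ ⊛ (⌜ m ⌝ ⊛ ⌜ k ⌝) ⊕ ⌜ lam ⌝) (⌜ k ⌝ ⊛ ⌜ k ⌝ ⊕ ⌜ lam ⌝ ⊛ ⌜ G.order ⌝) principal-relation

  count-formulas :
    (+ #G0) ℤ.* (+ (4 ℕ.* a ℕ.* a ℕ.* k ℕ.* (m ℕ.∸ 1)))
      ≡ (+ (G.order ℕ.∸ 1)) ℤ.* ((+ (4 ℕ.* a ℕ.* a ℕ.* k ℕ.* (m ℕ.∸ 1)))
                                 ℤ.- (+ (b ℕ.* b ℕ.∸ a ℕ.* a)) ℤ.* ((+ G.order) ℤ.- (+ (k ℕ.* m))) ℤ.* (+ m))
    × (+ #G+) ℤ.* (+ (8 ℕ.* a ℕ.* a ℕ.* b ℕ.* k ℕ.* (m ℕ.∸ 1)))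
      ≡ (+ (G.order ℕ.∸ 1)) ℤ.* ((+ G.order) ℤ.- (+ (k ℕ.* m))) ℤ.* (+ (b ℕ.* b ℕ.∸ a ℕ.* a))
          ℤ.* (+ ((b ℕ.∸ a) ℕ.* m ℕ.+ 2 ℕ.* a))
    × (+ #G-) ℤ.* (+ (8 ℕ.* a ℕ.* a ℕ.* b ℕ.* k ℕ.* (m ℕ.∸ 1)))
      ≡ (+ (G.order ℕ.∸ 1)) ℤ.* ((+ G.order) ℤ.- (+ (k ℕ.* m))) ℤ.* (+ (b ℕ.* b ℕ.∸ a ℕ.* a))
          ℤ.* (+ ((b ℕ.+ a) ℕ.* m ℕ.∸ 2 ℕ.* a))
  count-formulas = IntegerCounting.count-identities {+ G.order} {+ m} {+ k} {+ lam} {+ a} {+ b} {+ #G0} {+ #G+} {+ #G- }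
    {{ℕ.>-nonZero k≥1}}
    (≡.trans (pos-∸ (ℕP.*-mono-≤ a≤b a≤b)) (≡.cong₂ ℤ._-_ (ℤP.pos-* b b) (ℤP.pos-* a a)))
    (pos-⟦⟧ (⌜ 4 ⌝ ⊛ ⌜ lam ⌝ ⊛ ⌜ a ⌝ ⊛ ⌜ a ⌝))
    (ℤP.pos-* 2 a)
    (pos-∸ a≤b)
    (ℤP.pos-+ a b)
    (≡.trans (pos-⟦⟧ (⌜ 4 ⌝ ⊛ ⌜ a ⌝ ⊛ ⌜ a ⌝ ⊛ ⌜ k ⌝ ⊛ ⌜ m ℕ.∸ 1 ⌝)) (≡.cong (+ 4 ℤ.* + a ℤ.* + a ℤ.* + k ℤ.*_) (pos-∸ 1≤m)))
    (≡.trans (pos-⟦⟧ (⌜ 8 ⌝ ⊛ ⌜ a ⌝ ⊛ ⌜ a ⌝ ⊛ ⌜ b ⌝ ⊛ ⌜ k ⌝ ⊛ ⌜ m ℕ.∸ 1 ⌝)) (≡.cong (+ 8 ℤ.* + a ℤ.* + a ℤ.* + b ℤ.* + k ℤ.*_) (pos-∸ 1≤m)))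
    (pos-∸ 0<order)
    (ℤP.pos-* k m)
    (≡.trans (pos-⟦⟧ (⌜ b ℕ.∸ a ⌝ ⊛ ⌜ m ⌝ ⊕ ⌜ 2 ⌝ ⊛ ⌜ a ⌝)) (≡.cong (λ d → d ℤ.* + m ℤ.+ + 2 ℤ.* + a) (pos-∸ a≤b)))
    (≡.trans (pos-∸ 2a≤[b+a]m) (≡.cong₂ ℤ._-_ (pos-⟦⟧ ((⌜ b ⌝ ⊕ ⌜ a ⌝) ⊛ ⌜ m ⌝)) (pos-⟦⟧ (⌜ 2 ⌝ ⊛ ⌜ a ⌝))))
    partitionℤ parsevalℤ correlationℤ principalℤ
    where
    a≤b : a ℕ.≤ b
    a≤b = ℕP.<⇒≤ a<b
    1≤m : 1 ℕ.≤ m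
    1≤m = ℕP.<-trans (s≤s z≤n) m>2
    2a≤[b+a]m : 2 ℕ.* a ℕ.≤ (b ℕ.+ a) ℕ.* m
    2a≤[b+a]m = ℕP.≤-trans (≡.subst (ℕ._≤ b ℕ.+ a) (≡.cong (a ℕ.+_) (≡.sym (ℕP.+-identityʳ a))) (ℕP.+-monoˡ-≤ a a≤b))
                           (≡.subst (ℕ._≤ (b ℕ.+ a) ℕ.* m) (ℕP.*-identityʳ (b ℕ.+ a)) (ℕP.*-monoʳ-≤ (b ℕ.+ a) 1≤m))

module _ where
  open import Data.Nat.Base using (_<_; _∸_)
  import Data.Nat.Base as N
  open import Data.Integer.Base using (_-_; _*_)

  theorem5p4 : ∀ {c ℓ c' ℓ' : Level}
      (G : FiniteAbelianGroup c ℓ) (K : CommutativeRing c' ℓ') (dom : IsChar0DecDomain K)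
      (n : ℕ) (chars : Fin n → Character G K) → IsCharacterGroup G K n chars →
      n ≡ FiniteAbelianGroup.order G →
      (m k lam : ℕ) (Ds : Fin m → List (FiniteAbelianGroup.Carrier G)) →
      IsSEDF G m k lam Ds → 1 < k → (m>2 : 2 < m) →
      (a b : ℕ) → SimpleCharValueProp G K m lam Ds a b →
      let open Counts G K dom n chars m Ds (firstIdx G K m>2) a b
          v = FiniteAbelianGroup.order G
      in ((+ #G0) * (+ (4 N.* a N.* a N.* k N.* (m ∸ 1)))
            ≡ (+ (v ∸ 1)) * ((+ (4 N.* a N.* a N.* k N.* (m ∸ 1)))
                              - (+ (b N.* b ∸ a N.* a)) * ((+ v) - (+ (k N.* m))) * (+ m)))
         × ((+ #G+) * (+ (8 N.* a N.* a N.* b N.* k N.* (m ∸ 1)))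
            ≡ (+ (v ∸ 1)) * ((+ v) - (+ (k N.* m))) * (+ (b N.* b ∸ a N.* a))
                * (+ ((b ∸ a) N.* m N.+ 2 N.* a)))
         × ((+ #G-) * (+ (8 N.* a N.* a N.* b N.* k N.* (m ∸ 1)))
            ≡ (+ (v ∸ 1)) * ((+ v) - (+ (k N.* m))) * (+ (b N.* b ∸ a N.* a))
                * (+ ((b N.+ a) N.* m ∸ 2 N.* a)))
         × (0 < #G+ N.+ #G-)
  theorem5p4 G K dom n chars cg n≡v m k lam Ds sedf 1<k m>2 a b scvp =
    let count₀ , count₊ , count₋ = count-formulas in count₀ , count₊ , count₋ , counts-positive 1<k
    where open SimpleCharacterValues G K dom n chars cg n≡v m k lam Ds sedf m>2 a b scvp
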